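{- Let $t$ be an arbor on a finite set $I$. Then the polytope $Q_t\subset\mathbb{R}^I$ is a simple lattice polytope (that is, all its vertices have integer coordinates and it is a simple polytope).
   Context: An arbor on a finite non-empty set $I$ is a rooted tree whose vertices are labeled by pairwise disjoint non-empty subsets of $I$ whose union is $I$; we identify a vertex with its label set, and write $|v|$ for its cardinality. For a vertex $v$, a descendant of $v$ is a vertex $w$ such that the path from $w$ to the root passes through $v$ (including $w=v$), and $\mathscr{D}(v)\subseteq I$ is the union of the labels of all descendants of $v$. The polytope $Q_t\subset \mathbb{R}^I$ (coordinates $(x_i)_{i\in I}$) is defined by the inequalities $x_i\ge 0$ for all $i\in I$ and $\sum_{i\in\mathscr{D}(v)}x_i\le|\mathscr{D}(v)|$ for every vertex $v$ of $t$.
   Formalization: The polytope $Q_t$, with its vertices, edges and dimension, is taken in ℚ^I instead of $\mathbb{R}^I$. -}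

module Defs where

open import Data.Nat using (ℕ; zero; suc)
open import Data.Integer using (ℤ; +_)
open import Data.Rational using (ℚ; 0ℚ; 1ℚ; _+_; _*_; _-_; _≤_; _<_; _/_)
open import Data.Fin using (Fin)
open import Data.List using (List; []; _∷_; _++_; length; concatMap; map; foldr; allFin)
open import Data.List.Relation.Unary.All using (All)
open import Data.List.Relation.Binary.Permutation.Propositional using (_↭_)
open import Data.Product using (Σ; ∃; _×_; _,_)
open import Relation.Binary.PropositionalEquality using (_≡_)
open import Relation.Nullary using (¬_)

-- Ground set I = Fin n; points of ℚ^I are functions Fin n → ℚ.

Point : ℕ → Set
Point n = Fin n → ℚ

_≈ₚ_ : ∀ {n} → Point n → Point n → Set
x ≈ₚ y = ∀ i → x i ≡ y i

ℕ→ℚ : ℕ → ℚ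
ℕ→ℚ k = + k / 1

ℤ→ℚ : ℤ → ℚ
ℤ→ℚ k = k / 1

Σℚ : ∀ {k} → (Fin k → ℚ) → ℚ
Σℚ {zero}  f = 0ℚ
Σℚ {suc k} f = f Fin.zero + Σℚ (λ j → f (Fin.suc j))

sumOver : ∀ {n} → List (Fin n) → Point n → ℚ
sumOver is x = foldr (λ i acc → x i + acc) 0ℚ is

data Tree (n : ℕ) : Set where
  node : List (Fin n) → List (Tree n) → Tree n

descLabels : ∀ {n} → Tree n → List (Fin n)
descLabelsF : ∀ {n} → List (Tree n) → List (Fin n)
descLabels (node l cs) = l ++ descLabelsF cs
descLabelsF [] = []
descLabelsF (c ∷ cs) = descLabels c ++ descLabelsF cs

-- all vertices of a tree, each given as the subtree rooted there
subtrees : ∀ {n} → Tree n → List (Tree n)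
subtreesF : ∀ {n} → List (Tree n) → List (Tree n)
subtrees (node l cs) = node l cs ∷ subtreesF cs
subtreesF [] = []
subtreesF (c ∷ cs) = subtrees c ++ subtreesF cs

label : ∀ {n} → Tree n → List (Fin n)
label (node l _) = l

NonEmpty : ∀ {A : Set} → List A → Set
NonEmpty xs = ¬ (xs ≡ [])

-- An arbor on I = Fin n: every label is non-empty, and the labels are
-- pairwise disjoint (and duplicate-free) with union I; the latter two are
-- jointly expressed by: the concatenation of all labels is a permutation
-- of the list of all elements of I.
IsArbor : ∀ {n} → Tree n → Set
IsArbor {n} t = All (λ v → NonEmpty (label v)) (subtrees t) × (descLabels t ↭ allFin n)

Q : ∀ {n} → Tree n → Point n → Set
Q t x = (∀ i → 0ℚ ≤ x i)
      × All (λ v → sumOver (descLabels v) x ≤ ℕ→ℚ (length (descLabels v))) (subtrees t)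

comb : ∀ {n} → ℚ → Point n → Point n → Point n
comb λ' y z i = λ' * y i + (1ℚ - λ') * z i

InSeg : ∀ {n} → Point n → Point n → Point n → Set
InSeg u w p = Σ ℚ λ λ' → (0ℚ ≤ λ') × (λ' ≤ 1ℚ) × (p ≈ₚ comb λ' u w)

IsVertex : ∀ {n} → (Point n → Set) → Point n → Set
IsVertex P x = P x × (∀ y z λ' → P y → P z → 0ℚ < λ' → λ' < 1ℚ →
                       x ≈ₚ comb λ' y z → y ≈ₚ z)

IsEdge : ∀ {n} → (Point n → Set) → Point n → Point n → Set
IsEdge P u w = IsVertex P u × IsVertex P w × ¬ (u ≈ₚ w)
             × (∀ y z λ' → P y → P z → 0ℚ < λ' → λ' < 1ℚ →
                 InSeg u w (comb λ' y z) → InSeg u w y × InSeg u w z)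

AffIndep : ∀ {n k} → (Fin k → Point n) → Set
AffIndep {n} {k} p = ∀ (c : Fin k → ℚ) → Σℚ c ≡ 0ℚ
                   → (∀ i → Σℚ (λ j → c j * p j i) ≡ 0ℚ) → ∀ j → c j ≡ 0ℚ

HasDim : ∀ {n} → (Point n → Set) → ℕ → Set
HasDim {n} P d = (Σ (Fin (suc d) → Point n) λ p → (∀ j → P (p j)) × AffIndep p)
               × (∀ (p : Fin (suc (suc d)) → Point n) → (∀ j → P (p j)) → ¬ AffIndep p)

Bounded : ∀ {n} → (Point n → Set) → Set
Bounded P = Σ ℚ λ M → ∀ x → P x → ∀ i → (0ℚ - M ≤ x i) × (x i ≤ M)

IsSimple : ∀ {n} → (Point n → Set) → Set
IsSimple {n} P = Σ ℕ λ d → HasDim P d ×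
  (∀ v → IsVertex P v → Σ (Fin d → Point n) λ ws →
      (∀ j → IsEdge P v (ws j))
    × (∀ j k → ws j ≈ₚ ws k → j ≡ k)
    × (∀ w → IsEdge P v w → ∃ λ j → w ≈ₚ ws j))

IsLattice : ∀ {n} → (Point n → Set) → Set
IsLattice P = ∀ v → IsVertex P v → ∀ i → ∃ λ (k : ℤ) → v i ≡ ℤ→ℚ k

-- Q_t is cut out by the constraints x_i ≥ 0 and one constraint per vertex of t. At a vertex of
-- such a polyhedron the active constraints determine the point, so they have rank n; therefore,
-- if some n constraints cover all the active ones, they are active, distinct and independent,
-- and walking from the vertex along each of the n dual directions gives exactly n edges.
-- For Q_t such a cover exists at every point: an active vertex v of t has a positive coordinate
-- in its own label, since its children absorb at most their own sizes; so assign to i the vertex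
-- whose label contains i when x_i > 0, and the constraint x_i ≥ 0 otherwise. At a vertex of Q_t
-- this cover is injective and active: every label carries at most one positive coordinate and
-- its vertex is active, so reading the constraints from the root down, each coordinate is an
-- integer |𝒟(v)| minus a sum of integers.

module Submission where

open import Defs
open import Level using (0ℓ)
open import Function using (_∘_; id; _⇔_; mk⇔; Equivalence)
open import Data.Nat as ℕ using (ℕ; zero; suc; s≤s)
import Data.Nat.Properties as ℕ
open import Data.Integer as ℤ using (ℤ)
import Data.Integer.Properties as ℤ
open import Data.Rational using (ℚ; 0ℚ; 1ℚ; _+_; _*_; -_; _-_; _≤_; _<_; _⊓_; 1/_; ½; *≤*; *<*; toℚᵘ; positive; negative; nonNegative; ≢-nonZero)
open import Data.Rational.Properties
import Data.Rational.Unnormalised as ℚᵘ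
import Data.Rational.Unnormalised.Properties as ℚᵘ
open import Data.Fin using (Fin; zero; suc; punchIn; punchOut)
import Data.Fin.Properties as Fin
open import Data.Vec.Functional using (head; tail) renaming (_∷_ to _∷ᵥ_)
open import Data.List using (List; []; _∷_; _++_; length; lookup; allFin; map; filter; concat; concatMap)
open import Data.List.Properties using (length-++; map-++; concat-++)
open import Data.List.Membership.Propositional using (_∈_; _∉_; lose)
open import Data.List.Membership.Propositional.Properties using (∈-++⁺ˡ; ∈-++⁺ʳ; ∈-++⁻; ∈-lookup; ∈-allFin; ∈-map⁺; ∈-filter⁺; ∈-concatMap⁺; ∈-concatMap⁻)
open import Data.List.Relation.Unary.Any using (Any; here; there; index; any?; satisfied)
open import Data.List.Relation.Unary.Any.Properties using (lookup-index)
open import Data.List.Relation.Unary.All as All using (All)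
open import Data.List.Relation.Unary.All.Properties using (all-filter; ++⁻ˡ) renaming (map⁺ to All-map⁺)
open import Data.List.Relation.Unary.AllPairs using ([]; _∷_)
open import Data.List.Relation.Unary.Unique.Propositional using (Unique)
open import Data.List.Relation.Unary.Unique.Propositional.Properties using (allFin⁺)
open import Data.List.Relation.Binary.Permutation.Propositional using (↭-sym; ↭⇒↭ₛ)
open import Data.List.Relation.Binary.Permutation.Propositional.Properties using (∈-resp-↭)
open import Data.List.Relation.Binary.Permutation.Setoid.Properties using (Unique-resp-↭)
open import Data.Product using (Σ; ∃; _×_; _,_; proj₁; proj₂)
open import Data.Sum using (_⊎_; inj₁; inj₂)
import Data.Sum.Properties as Sum
open import Relation.Nullary using (¬_; yes; no; contradiction; ¬?; _×-dec_)
open import Relation.Nullary.Decidable using (dec⇒maybe; decidable-stable)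
open import Relation.Binary.Bundles using (TotalOrder)
import Data.List.Extrema as Extrema
open import Relation.Binary.Definitions using (DecidableEquality; tri<; tri≈; tri>)
open import Relation.Binary.PropositionalEquality
open import Tactic.RingSolver using (solve-∀)
open import Tactic.RingSolver.Core.AlmostCommutativeRing using (AlmostCommutativeRing; fromCommutativeRing)

-- Arithmetic in ℚ

ℚ-ring : AlmostCommutativeRing 0ℓ 0ℓ
ℚ-ring = fromCommutativeRing +-*-commutativeRing (λ p → dec⇒maybe (0ℚ ≟ p))

0<1 : 0ℚ < 1ℚ
0<1 = *<* (ℤ.+<+ (s≤s ℕ.z≤n))

0<½ : 0ℚ < ½
0<½ = *<* (ℤ.+<+ (s≤s ℕ.z≤n))

½<1 : ½ < 1ℚ
½<1 = *<* (ℤ.+<+ (s≤s (s≤s ℕ.z≤n)))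

module _ {p q : ℚ} where

  ≤-by-gap : ∀ r → q ≡ p + r → 0ℚ ≤ r → p ≤ q
  ≤-by-gap r q≡p+r 0≤r = subst₂ _≤_ (+-identityʳ p) (sym q≡p+r) (+-monoʳ-≤ p 0≤r)

  <-by-gap : ∀ r → q ≡ p + r → 0ℚ < r → p < q
  <-by-gap r q≡p+r 0<r = subst₂ _<_ (+-identityʳ p) (sym q≡p+r) (+-monoʳ-< p 0<r)

  p≤q⇒0≤q-p : p ≤ q → 0ℚ ≤ q - p
  p≤q⇒0≤q-p p≤q = subst (_≤ q - p) (+-inverseʳ p) (+-monoˡ-≤ (- p) p≤q)

  p<q⇒0<q-p : p < q → 0ℚ < q - p
  p<q⇒0<q-p p<q = subst (_< q - p) (+-inverseʳ p) (+-monoˡ-< (- p) p<q)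

  ≤∧≢⇒< : p ≤ q → p ≢ q → p < q
  ≤∧≢⇒< p≤q p≢q with p <? q
  ... | yes p<q = p<q
  ... | no p≮q = contradiction (≤-antisym p≤q (≮⇒≥ p≮q)) p≢q

  nonNeg*nonNeg : 0ℚ ≤ p → 0ℚ ≤ q → 0ℚ ≤ p * q
  nonNeg*nonNeg 0≤p 0≤q = nonNegative⁻¹ _ {{nonNeg*nonNeg⇒nonNeg p {{nonNegative 0≤p}} q {{nonNegative 0≤q}}}}

  ⊓-pos : 0ℚ < p → 0ℚ < q → 0ℚ < p ⊓ q
  ⊓-pos 0<p 0<q with ⊓-sel p q
  ... | inj₁ p⊓q≡p = subst (0ℚ <_) (sym p⊓q≡p) 0<p
  ... | inj₂ p⊓q≡q = subst (0ℚ <_) (sym p⊓q≡q) 0<q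

  pos*pos : 0ℚ < p → 0ℚ < q → 0ℚ < p * q
  pos*pos 0<p 0<q = positive⁻¹ _ {{pos*pos⇒pos p {{positive 0<p}} q {{positive 0<q}}}}

+-cancelˡ-≤ : ∀ {u p q} → u + p ≤ u + q → p ≤ q
+-cancelˡ-≤ {u} {p} {q} u+p≤u+q = subst₂ _≤_ (cancel u p) (cancel u q) (+-monoʳ-≤ (- u) u+p≤u+q)
  where
  cancel : ∀ u p → - u + (u + p) ≡ p
  cancel = solve-∀ ℚ-ring

+-cancelʳ-≤ : ∀ {p q r} → p + r ≤ q + r → p ≤ q
+-cancelʳ-≤ {p} {q} {r} p+r≤q+r = +-cancelˡ-≤ {r} (subst₂ _≤_ (+-comm p r) (+-comm q r) p+r≤q+r)

-p≤0⇒0≤p : ∀ {p} → - p ≤ 0ℚ → 0ℚ ≤ p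
-p≤0⇒0≤p {p} -p≤0 = subst (0ℚ ≤_) (neg-involutive p) (neg-antimono-≤ -p≤0)
  where
  neg-involutive : ∀ p → - - p ≡ p
  neg-involutive = solve-∀ ℚ-ring

p+[q-p]≡q : ∀ p q → p + (q - p) ≡ q
p+[q-p]≡q = solve-∀ ℚ-ring

-- A total reciprocal, with the junk value recip 0 = 0.
recip : ℚ → ℚ
recip p with p ≟ 0ℚ
... | yes _ = 0ℚ
... | no p≢0 = (1/ p) {{≢-nonZero p≢0}}

p*recip[p]≡1 : ∀ {p} → p ≢ 0ℚ → p * recip p ≡ 1ℚ
p*recip[p]≡1 {p} p≢0 with p ≟ 0ℚ
... | yes p≡0 = contradiction p≡0 p≢0
... | no p≢0 = *-inverseʳ p {{≢-nonZero p≢0}}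

recip-pos : ∀ {p} → 0ℚ < p → 0ℚ < recip p
recip-pos {p} 0<p with p ≟ 0ℚ
... | yes p≡0 = contradiction (sym p≡0) (<⇒≢ 0<p)
... | no p≢0 = positive⁻¹ _ {{1/pos⇒pos p {{positive 0<p}}}}

q*recip[p]*p≡q : ∀ q {p} → p ≢ 0ℚ → (q * recip p) * p ≡ q
q*recip[p]*p≡q q {a} a≢0 = trans (*-assoc q (recip a) a)
  (trans (cong (q *_) (trans (*-comm (recip a) a) (p*recip[p]≡1 a≢0))) (*-identityʳ q))

p*q≡0⇒q≡0 : ∀ {p q} → p ≢ 0ℚ → p * q ≡ 0ℚ → q ≡ 0ℚ
p*q≡0⇒q≡0 {p} {q} p≢0 p*q≡0 = begin
  q                    ≡⟨ *-identityˡ q ⟨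
  1ℚ * q               ≡⟨ cong (_* q) (trans (*-comm (recip p) p) (p*recip[p]≡1 p≢0)) ⟨
  (recip p * p) * q    ≡⟨ *-assoc (recip p) p q ⟩
  recip p * (p * q)    ≡⟨ cong (recip p *_) p*q≡0 ⟩
  recip p * 0ℚ         ≡⟨ *-zeroʳ (recip p) ⟩
  0ℚ                   ∎
  where open ≡-Reasoning

module _ {l u v B : ℚ} where

  comb-≤-bound : 0ℚ ≤ l → l ≤ 1ℚ → u ≤ B → v ≤ B → l * u + (1ℚ - l) * v ≤ B
  comb-≤-bound 0≤l l≤1 u≤B v≤B =
    ≤-by-gap (l * (B - u) + (1ℚ - l) * (B - v)) (gap l u v B)
             (+-mono-≤ (nonNeg*nonNeg 0≤l (p≤q⇒0≤q-p u≤B))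
                       (nonNeg*nonNeg (p≤q⇒0≤q-p l≤1) (p≤q⇒0≤q-p v≤B)))
    where
    gap : ∀ l u v B → B ≡ (l * u + (1ℚ - l) * v) + (l * (B - u) + (1ℚ - l) * (B - v))
    gap = solve-∀ ℚ-ring

  -- B - (l u + (1 - l) v) = l (B - u) + (1 - l) (B - v), a sum of two nonnegative terms.
  comb-attains-bound : 0ℚ < l → l < 1ℚ → u ≤ B → v ≤ B → l * u + (1ℚ - l) * v ≡ B → u ≡ B × v ≡ B
  comb-attains-bound 0<l l<1 u≤B v≤B comb≡B = attained u≤B left , attained v≤B right
    where
    gap : ∀ l u v B → l * (B - u) + (1ℚ - l) * (B - v) ≡ B - (l * u + (1ℚ - l) * v)
    gap = solve-∀ ℚ-ring
    no-gap : l * (B - u) + (1ℚ - l) * (B - v) ≡ 0ℚ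
    no-gap = trans (gap l u v B) (trans (cong (λ c → B - c) comb≡B) (+-inverseʳ B))
    attained : ∀ {w} → w ≤ B → (0ℚ < B - w → 0ℚ < l * (B - u) + (1ℚ - l) * (B - v)) → w ≡ B
    attained {w} w≤B positive-gap with w ≟ B
    ... | yes w≡B = w≡B
    ... | no w≢B = contradiction no-gap (<⇒≢ (positive-gap (p<q⇒0<q-p (≤∧≢⇒< w≤B w≢B))) ∘ sym)
    left : 0ℚ < B - u → 0ℚ < l * (B - u) + (1ℚ - l) * (B - v)
    left 0<B-u = +-mono-<-≤ (pos*pos 0<l 0<B-u) (nonNeg*nonNeg (<⇒≤ (p<q⇒0<q-p l<1)) (p≤q⇒0≤q-p v≤B))
    right : 0ℚ < B - v → 0ℚ < l * (B - u) + (1ℚ - l) * (B - v)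
    right 0<B-v = +-mono-≤-< (nonNeg*nonNeg (<⇒≤ 0<l) (p≤q⇒0≤q-p u≤B)) (pos*pos (p<q⇒0<q-p l<1) 0<B-v)

ray-nonIncreasing : ∀ {u s a} → 0ℚ ≤ s → a ≤ 0ℚ → u + s * a ≤ u
ray-nonIncreasing {u} {s} {a} 0≤s a≤0 = subst (u + s * a ≤_) (+-identityʳ u)
  (+-monoʳ-≤ u (subst (s * a ≤_) (*-zeroʳ s) (*-monoˡ-≤-nonNeg s {{nonNegative 0≤s}} a≤0)))

ray-decreasing : ∀ {u t a} → 0ℚ < t → a < 0ℚ → u + t * a < u
ray-decreasing {u} {t} {a} 0<t a<0 = subst (u + t * a <_) (+-identityʳ u)
  (+-monoʳ-< u (subst (t * a <_) (*-zeroʳ t) (*-monoʳ-<-pos t {{positive 0<t}} a<0)))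

ray-step-below : ∀ {u t a B} → u ≤ B → 0ℚ ≤ t → (0ℚ < a → t * a ≤ B - u) → u + t * a ≤ B
ray-step-below {u} {t} {a} {B} u≤B 0≤t short with 0ℚ <? a
... | yes 0<a = subst (u + t * a ≤_) (p+[q-p]≡q u B) (+-monoʳ-≤ u (short 0<a))
... | no 0≮a = ≤-trans (ray-nonIncreasing 0≤t (≮⇒≥ 0≮a)) u≤B

ray-below : ∀ {u a B} → u ≤ B → (u ≡ B → a ≡ 0ℚ)
          → ∃ λ ε → 0ℚ < ε × ∀ s → 0ℚ ≤ s → s ≤ ε → u + s * a ≤ B
ray-below {u} {a} {B} u≤B tight⇒a≡0 with u ≟ B | 0ℚ <? a
... | yes u≡B | _ = 1ℚ , 0<1 , λ s _ _ → ≤-reflexive (trans (stays s) u≡B)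
  where
  stays : ∀ s → u + s * a ≡ u
  stays s = trans (cong (λ c → u + s * c) (tight⇒a≡0 u≡B)) (trans (cong (u +_) (*-zeroʳ s)) (+-identityʳ u))
... | no _ | no 0≮a = 1ℚ , 0<1 , λ s 0≤s _ → ≤-trans (ray-nonIncreasing 0≤s (≮⇒≥ 0≮a)) u≤B
... | no u≢B | yes 0<a = ε , pos*pos (p<q⇒0<q-p (≤∧≢⇒< u≤B u≢B)) (recip-pos 0<a) , λ s 0≤s s≤ε →
  ray-step-below u≤B 0≤s λ _ → subst (s * a ≤_) (q*recip[p]*p≡q (B - u) (<⇒≢ 0<a ∘ sym))
                                     (*-monoʳ-≤-nonNeg a {{nonNegative (<⇒≤ 0<a)}} s≤ε)
  where
  ε = (B - u) * recip a

ray-escapes : ∀ {u c M} → 0ℚ - M ≤ u → u ≤ M → c ≢ 0ℚ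
            → ∃ λ s → 0ℚ ≤ s × ¬ ((0ℚ - M ≤ u + s * c) × (u + s * c ≤ M))
ray-escapes {u} {c} {M} -M≤u u≤M c≢0 with 0ℚ <? c
... | yes 0<c = s , nonNeg*nonNeg room (<⇒≤ (recip-pos 0<c)) , λ (_ , ≤M) → <-irrefl refl (<-≤-trans above ≤M)
  where
  room : 0ℚ ≤ M - u + 1ℚ
  room = +-mono-≤ (p≤q⇒0≤q-p u≤M) (<⇒≤ 0<1)
  s = (M - u + 1ℚ) * recip c
  lands : ∀ u M → u + (M - u + 1ℚ) ≡ M + 1ℚ
  lands = solve-∀ ℚ-ring
  above : M < u + s * c
  above = <-by-gap 1ℚ (trans (cong (u +_) (q*recip[p]*p≡q (M - u + 1ℚ) c≢0)) (lands u M)) 0<1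
... | no 0≮c = s , nonNeg*nonNeg room (<⇒≤ (recip-pos 0<-c)) , λ (-M≤ , _) → <-irrefl refl (<-≤-trans below -M≤)
  where
  0<-c : 0ℚ < - c
  0<-c = subst (0ℚ <_) (+-identityˡ (- c)) (p<q⇒0<q-p (≤∧≢⇒< (≮⇒≥ 0≮c) c≢0))
  room : 0ℚ ≤ u + M + 1ℚ
  room = +-mono-≤ (subst (0ℚ ≤_) (u-[0-M]≡u+M u M) (p≤q⇒0≤q-p -M≤u)) (<⇒≤ 0<1)
    where
    u-[0-M]≡u+M : ∀ u M → u - (0ℚ - M) ≡ u + M
    u-[0-M]≡u+M = solve-∀ ℚ-ring
  s = (u + M + 1ℚ) * recip (- c)
  s*c≡ : s * c ≡ - (u + M + 1ℚ)
  s*c≡ = trans (neg-swap s c) (cong -_ (q*recip[p]*p≡q (u + M + 1ℚ) (<⇒≢ 0<-c ∘ sym)))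
    where
    neg-swap : ∀ s c → s * c ≡ - (s * - c)
    neg-swap = solve-∀ ℚ-ring
  lands : ∀ u M → (u + - (u + M + 1ℚ)) + 1ℚ ≡ 0ℚ - M
  lands = solve-∀ ℚ-ring
  below : u + s * c < 0ℚ - M
  below = <-by-gap 1ℚ (sym (trans (cong (λ w → u + w + 1ℚ) s*c≡) (lands u M))) 0<1

ray-param-nonNeg : ∀ {u τ a} → u + τ * a ≤ u → a < 0ℚ → 0ℚ ≤ τ
ray-param-nonNeg {u} {τ} {a} below a<0 = *-cancelʳ-≤-neg a {{negative a<0}}
  (subst (τ * a ≤_) (sym (*-zeroˡ a)) (+-cancelˡ-≤ {u} (subst (u + τ * a ≤_) (sym (+-identityʳ u)) below)))

ray-param-≤ : ∀ {u τ t a} → u + τ * a ≤ u + t * a → 0ℚ < a → τ ≤ t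
ray-param-≤ {u} {a = a} below 0<a = *-cancelʳ-≤-pos a {{positive 0<a}} (+-cancelˡ-≤ {u} below)

ray-param-unique : ∀ {u p q a} → a ≢ 0ℚ → u + p * a ≡ u + q * a → p ≡ q
ray-param-unique {u} {p} {q} {a} a≢0 same = begin
  p                 ≡⟨ p≡[p-q]+q p q ⟩
  (p - q) + q       ≡⟨ cong (_+ q) (p*q≡0⇒q≡0 a≢0 a*[p-q]≡0) ⟩
  0ℚ + q            ≡⟨ +-identityˡ q ⟩
  q                 ∎
  where
  open ≡-Reasoning
  p≡[p-q]+q : ∀ p q → p ≡ (p - q) + q
  p≡[p-q]+q = solve-∀ ℚ-ring
  difference : ∀ u p q a → a * (p - q) ≡ (u + p * a) - (u + q * a)
  difference = solve-∀ ℚ-ring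
  a*[p-q]≡0 : a * (p - q) ≡ 0ℚ
  a*[p-q]≡0 = trans (difference u p q a) (trans (cong (_- (u + q * a)) same) (+-inverseʳ (u + q * a)))

segment-param : ∀ {τ t} → 0ℚ ≤ τ → τ ≤ t → 0ℚ < t
              → ∃ λ l → 0ℚ ≤ l × l ≤ 1ℚ × ∀ x d → x + τ * d ≡ l * x + (1ℚ - l) * (x + t * d)
segment-param {τ} {t} 0≤τ τ≤t 0<t = 1ℚ - τ * r , 0≤l , l≤1 , on-segment
  where
  r = recip t
  t≢0 : t ≢ 0ℚ
  t≢0 = <⇒≢ 0<t ∘ sym
  0≤r : 0ℚ ≤ r
  0≤r = <⇒≤ (recip-pos 0<t)
  0≤l : 0ℚ ≤ 1ℚ - τ * r
  0≤l = p≤q⇒0≤q-p (subst (τ * r ≤_) (p*recip[p]≡1 t≢0) (*-monoʳ-≤-nonNeg r {{nonNegative 0≤r}} τ≤t))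
  l≤1 : 1ℚ - τ * r ≤ 1ℚ
  l≤1 = ≤-by-gap (τ * r) (sym (1-a+a≡1 (τ * r))) (nonNeg*nonNeg 0≤τ 0≤r)
    where
    1-a+a≡1 : ∀ a → (1ℚ - a) + a ≡ 1ℚ
    1-a+a≡1 = solve-∀ ℚ-ring
  on-segment : ∀ x d → x + τ * d ≡ (1ℚ - τ * r) * x + (1ℚ - (1ℚ - τ * r)) * (x + t * d)
  on-segment x d = begin
    x + τ * d                                                          ≡⟨ insert-one x d τ ⟩
    x + τ * 1ℚ * d                                                     ≡⟨ cong (λ c → x + τ * c * d) (p*recip[p]≡1 t≢0) ⟨
    x + τ * (t * r) * d                                                ≡⟨ regroup x d τ t r ⟩
    (1ℚ - τ * r) * x + (1ℚ - (1ℚ - τ * r)) * (x + t * d)               ∎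
    where
    open ≡-Reasoning
    insert-one : ∀ x d τ → x + τ * d ≡ x + τ * 1ℚ * d
    insert-one = solve-∀ ℚ-ring
    regroup : ∀ x d τ t r → x + τ * (t * r) * d ≡ (1ℚ - τ * r) * x + (1ℚ - (1ℚ - τ * r)) * (x + t * d)
    regroup = solve-∀ ℚ-ring

ℤ→ℚ-homo-+ : ∀ a b → ℤ→ℚ (a ℤ.+ b) ≡ ℤ→ℚ a + ℤ→ℚ b
ℤ→ℚ-homo-+ a b = toℚᵘ-injective (begin
  toℚᵘ (ℤ→ℚ (a ℤ.+ b))                     ≈⟨ toℚᵘ-fromℚᵘ (ℚᵘ.mkℚᵘ (a ℤ.+ b) 0) ⟩
  ℚᵘ.mkℚᵘ (a ℤ.+ b) 0                      ≈⟨ ℚᵘ.*≡* (cong (ℤ._* ℤ.+ 1) (sym (cong₂ ℤ._+_ (ℤ.*-identityʳ a)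
                                                                                         (ℤ.*-identityʳ b)))) ⟩
  ℚᵘ.mkℚᵘ a 0 ℚᵘ.+ ℚᵘ.mkℚᵘ b 0             ≈⟨ ℚᵘ.+-cong (toℚᵘ-fromℚᵘ (ℚᵘ.mkℚᵘ a 0))
                                                         (toℚᵘ-fromℚᵘ (ℚᵘ.mkℚᵘ b 0)) ⟨
  toℚᵘ (ℤ→ℚ a) ℚᵘ.+ toℚᵘ (ℤ→ℚ b)           ≈⟨ toℚᵘ-homo-+ (ℤ→ℚ a) (ℤ→ℚ b) ⟨
  toℚᵘ (ℤ→ℚ a + ℤ→ℚ b)                     ∎)
  where open ℚᵘ.≃-Reasoning

ℤ→ℚ-homo‿- : ∀ a → ℤ→ℚ (ℤ.- a) ≡ - ℤ→ℚ a
ℤ→ℚ-homo‿- a = toℚᵘ-injective (begin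
  toℚᵘ (ℤ→ℚ (ℤ.- a))        ≈⟨ toℚᵘ-fromℚᵘ (ℚᵘ.mkℚᵘ (ℤ.- a) 0) ⟩
  ℚᵘ.mkℚᵘ (ℤ.- a) 0         ≈⟨ ℚᵘ.-‿cong (toℚᵘ-fromℚᵘ (ℚᵘ.mkℚᵘ a 0)) ⟨
  ℚᵘ.- toℚᵘ (ℤ→ℚ a)         ≈⟨ toℚᵘ-homo‿- (ℤ→ℚ a) ⟨
  toℚᵘ (- ℤ→ℚ a)            ∎)
  where open ℚᵘ.≃-Reasoning

Integral : ℚ → Set
Integral q = ∃ λ k → q ≡ ℤ→ℚ k

integral-+ : ∀ {p q} → Integral p → Integral q → Integral (p + q)
integral-+ (k , p≡k) (l , q≡l) = k ℤ.+ l , trans (cong₂ _+_ p≡k q≡l) (sym (ℤ→ℚ-homo-+ k l))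

integral-‿- : ∀ {p} → Integral p → Integral (- p)
integral-‿- (k , p≡k) = ℤ.- k , trans (cong -_ p≡k) (sym (ℤ→ℚ-homo‿- k))

ℕ→ℚ-integral : ∀ a → Integral (ℕ→ℚ a)
ℕ→ℚ-integral a = ℤ.+ a , refl

ℕ→ℚ-nonNeg : ∀ a → 0ℚ ≤ ℕ→ℚ a
1≤ℕ→ℚ-suc : ∀ a → 1ℚ ≤ ℕ→ℚ (suc a)

ℕ→ℚ-nonNeg zero = ≤-refl
ℕ→ℚ-nonNeg (suc a) = ≤-trans (<⇒≤ 0<1) (1≤ℕ→ℚ-suc a)

1≤ℕ→ℚ-suc a = ≤-by-gap (ℕ→ℚ a) (ℤ→ℚ-homo-+ (ℤ.+ 1) (ℤ.+ a)) (ℕ→ℚ-nonNeg a)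

-- Linear algebra in ℚⁿ

shift : ∀ {n} → Point n → ℚ → Point n → Point n
shift x t d i = x i + t * d i

_-ₚ_ : ∀ {n} → Point n → Point n → Point n
(y -ₚ x) i = y i - x i

0ₚ : ∀ {n} → Point n
0ₚ _ = 0ℚ

negₚ : ∀ {n} → Point n → Point n
negₚ d i = - d i

Nonzero : ∀ {n} → Point n → Set
Nonzero d = ∃ λ j → d j ≢ 0ℚ

record Linear {n} (φ : Point n → ℚ) : Set where
  field
    shift-hom : ∀ x t d → φ (shift x t d) ≡ φ x + t * φ d
    resp-≈ : ∀ {x y} → x ≈ₚ y → φ x ≡ φ y

  zero-hom : φ 0ₚ ≡ 0ℚ
  zero-hom = begin
    φ 0ₚ                        ≡⟨ a≡a+1*a-a (φ 0ₚ) ⟩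
    (φ 0ₚ + 1ℚ * φ 0ₚ) - φ 0ₚ   ≡⟨ cong (_- φ 0ₚ) (shift-hom 0ₚ 1ℚ 0ₚ) ⟨
    φ (shift 0ₚ 1ℚ 0ₚ) - φ 0ₚ   ≡⟨ cong (_- φ 0ₚ) (resp-≈ λ _ → refl) ⟩
    φ 0ₚ - φ 0ₚ                 ≡⟨ +-inverseʳ (φ 0ₚ) ⟩
    0ℚ                          ∎
    where
    open ≡-Reasoning
    a≡a+1*a-a : ∀ a → a ≡ (a + 1ℚ * a) - a
    a≡a+1*a-a = solve-∀ ℚ-ring

  neg-hom : ∀ d → φ (negₚ d) ≡ - φ d
  neg-hom d = begin
    φ (negₚ d)                 ≡⟨ resp-≈ (λ i → -a≡0+-1*a (d i)) ⟩
    φ (shift 0ₚ (- 1ℚ) d)      ≡⟨ shift-hom 0ₚ (- 1ℚ) d ⟩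
    φ 0ₚ + (- 1ℚ) * φ d        ≡⟨ cong (λ z → z + (- 1ℚ) * φ d) zero-hom ⟩
    0ℚ + (- 1ℚ) * φ d          ≡⟨ -a≡0+-1*a (φ d) ⟨
    - φ d                      ∎
    where
    open ≡-Reasoning
    -a≡0+-1*a : ∀ a → - a ≡ 0ℚ + (- 1ℚ) * a
    -a≡0+-1*a = solve-∀ ℚ-ring

  neg-kernel : ∀ {d} → φ d ≡ 0ℚ → φ (negₚ d) ≡ 0ℚ
  neg-kernel {d} φd≡0 = trans (neg-hom d) (cong -_ φd≡0)

  -ₚ-hom : ∀ y x → φ (y -ₚ x) ≡ φ y - φ x
  -ₚ-hom y x = begin
    φ (y -ₚ x)                      ≡⟨ a≡c+1*a-c (φ (y -ₚ x)) (φ x) ⟩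
    (φ x + 1ℚ * φ (y -ₚ x)) - φ x   ≡⟨ cong (_- φ x) (shift-hom x 1ℚ (y -ₚ x)) ⟨
    φ (shift x 1ℚ (y -ₚ x)) - φ x   ≡⟨ cong (_- φ x) (resp-≈ (λ i → x+1*[y-x]≡y (x i) (y i))) ⟩
    φ y - φ x                       ∎
    where
    open ≡-Reasoning
    a≡c+1*a-c : ∀ a c → a ≡ (c + 1ℚ * a) - c
    a≡c+1*a-c = solve-∀ ℚ-ring
    x+1*[y-x]≡y : ∀ x y → x + 1ℚ * (y - x) ≡ y
    x+1*[y-x]≡y = solve-∀ ℚ-ring

  comb-hom : ∀ l y z → φ (comb l y z) ≡ l * φ y + (1ℚ - l) * φ z
  comb-hom l y z = begin
    φ (comb l y z)              ≡⟨ resp-≈ (λ i → comb≡shift l (y i) (z i)) ⟩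
    φ (shift z l (y -ₚ z))      ≡⟨ shift-hom z l (y -ₚ z) ⟩
    φ z + l * φ (y -ₚ z)        ≡⟨ cong (λ w → φ z + l * w) (-ₚ-hom y z) ⟩
    φ z + l * (φ y - φ z)       ≡⟨ shift≡comb l (φ y) (φ z) ⟩
    l * φ y + (1ℚ - l) * φ z    ∎
    where
    open ≡-Reasoning
    comb≡shift : ∀ l y z → l * y + (1ℚ - l) * z ≡ z + l * (y - z)
    comb≡shift = solve-∀ ℚ-ring
    shift≡comb : ∀ l a c → c + l * (a - c) ≡ l * a + (1ℚ - l) * c
    shift≡comb = solve-∀ ℚ-ring

  shift-kernel : ∀ x t {d} → φ d ≡ 0ℚ → φ (shift x t d) ≡ φ x
  shift-kernel x t {d} φd≡0 = begin
    φ (shift x t d)   ≡⟨ shift-hom x t d ⟩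
    φ x + t * φ d     ≡⟨ cong (λ w → φ x + t * w) φd≡0 ⟩
    φ x + t * 0ℚ      ≡⟨ cong (φ x +_) (*-zeroʳ t) ⟩
    φ x + 0ℚ          ≡⟨ +-identityʳ (φ x) ⟩
    φ x               ∎
    where open ≡-Reasoning

open Linear public

LinearMap : ∀ {k l} → (Point k → Point l) → Set
LinearMap ι = ∀ j → Linear (λ y → ι y j)

linear-∘ : ∀ {k l} {φ : Point l → ℚ} {ι : Point k → Point l} → Linear φ → LinearMap ι → Linear (φ ∘ ι)
linear-∘ {φ = φ} {ι} φ-lin ι-lin = record
  { shift-hom = λ x t d → trans (resp-≈ φ-lin (λ j → shift-hom (ι-lin j) x t d)) (shift-hom φ-lin (ι x) t (ι d))
  ; resp-≈ = λ x≈y → resp-≈ φ-lin (λ j → resp-≈ (ι-lin j) x≈y)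
  }

coordinate-linear : ∀ {k} (j : Fin k) → Linear (λ y → y j)
coordinate-linear j = record { shift-hom = λ _ _ _ → refl ; resp-≈ = λ x≈y → x≈y j }

scale-linear : ∀ {k} {φ : Point k → ℚ} a → Linear φ → Linear (λ y → a * φ y)
scale-linear {φ = φ} a φ-lin = record
  { shift-hom = λ x t d → trans (cong (a *_) (shift-hom φ-lin x t d)) (distrib a (φ x) t (φ d))
  ; resp-≈ = λ x≈y → cong (a *_) (resp-≈ φ-lin x≈y)
  }
  where
  distrib : ∀ a u t v → a * (u + t * v) ≡ a * u + t * (a * v)
  distrib = solve-∀ ℚ-ring

zero-linear : ∀ {k} → Linear {k} (λ _ → 0ℚ)
zero-linear = record { shift-hom = λ _ t _ → sym (0+t*0≡0 t) ; resp-≈ = λ _ → refl }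
  where
  0+t*0≡0 : ∀ t → 0ℚ + t * 0ℚ ≡ 0ℚ
  0+t*0≡0 = solve-∀ ℚ-ring

0∷ᵥ-linear : ∀ {k} → LinearMap {k} (0ℚ ∷ᵥ_)
0∷ᵥ-linear zero = zero-linear
0∷ᵥ-linear (suc j) = coordinate-linear j

tail-linear : ∀ {k} → LinearMap {suc k} tail
tail-linear j = coordinate-linear (suc j)

e₀ : ∀ {k} → Point (suc k)
e₀ = 1ℚ ∷ᵥ 0ₚ

∷ᵥ-split : ∀ {k} {φ : Point (suc k) → ℚ} → Linear φ → ∀ s y → φ (s ∷ᵥ y) ≡ φ (0ℚ ∷ᵥ y) + s * φ e₀
∷ᵥ-split φ-lin s y = trans (resp-≈ φ-lin pointwise) (shift-hom φ-lin (0ℚ ∷ᵥ y) s e₀)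
  where
  s≡0+s*1 : ∀ s → s ≡ 0ℚ + s * 1ℚ
  s≡0+s*1 = solve-∀ ℚ-ring
  a≡a+s*0 : ∀ a s → a ≡ a + s * 0ℚ
  a≡a+s*0 = solve-∀ ℚ-ring
  pointwise : (s ∷ᵥ y) ≈ₚ shift (0ℚ ∷ᵥ y) s e₀
  pointwise zero = s≡0+s*1 s
  pointwise (suc i) = a≡a+s*0 (y i) s

negₚ-nonzero : ∀ {n} {d : Point n} → Nonzero d → Nonzero (negₚ d)
negₚ-nonzero (j , dj≢0) = j , λ -dj≡0 → dj≢0 (neg-injective -dj≡0)

record KernelEmbedding {k} (φ : Point (suc k) → ℚ) : Set where
  field
    ι : Point k → Point (suc k)
    ι-linear : LinearMap ι
    ι-kernel : ∀ y → φ (ι y) ≡ 0ℚ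
    ι-nonzero : ∀ y → Nonzero y → Nonzero (ι y)

-- If φ e₀ ≠ 0 solve for the first coordinate; otherwise keep it free and recurse on the rest.
kernel-embedding : ∀ {k} {φ : Point (suc k) → ℚ} → Linear φ → KernelEmbedding φ
kernel-embedding {k} {φ} φ-lin with φ e₀ ≟ 0ℚ
... | no φe₀≢0 = record
  { ι = λ y → c y ∷ᵥ y
  ; ι-linear = λ { zero → c-linear ; (suc j) → coordinate-linear j }
  ; ι-kernel = kernel
  ; ι-nonzero = λ { y (j , yj≢0) → suc j , yj≢0 }
  }
  where
  ψ-linear : Linear (φ ∘ (0ℚ ∷ᵥ_))
  ψ-linear = linear-∘ φ-lin 0∷ᵥ-linear
  c : Point k → ℚ
  c y = (- recip (φ e₀)) * φ (0ℚ ∷ᵥ y)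
  c-linear : Linear c
  c-linear = scale-linear (- recip (φ e₀)) ψ-linear
  cancel : ∀ a r e → e * r ≡ 1ℚ → a + ((- r) * a) * e ≡ 0ℚ
  cancel a r e e*r≡1 = begin
    a + ((- r) * a) * e   ≡⟨ rearrange a r e ⟩
    a - a * (e * r)       ≡⟨ cong (λ w → a - a * w) e*r≡1 ⟩
    a - a * 1ℚ            ≡⟨ a-a*1≡0 a ⟩
    0ℚ                    ∎
    where
    open ≡-Reasoning
    rearrange : ∀ a r e → a + ((- r) * a) * e ≡ a - a * (e * r)
    rearrange = solve-∀ ℚ-ring
    a-a*1≡0 : ∀ a → a - a * 1ℚ ≡ 0ℚ
    a-a*1≡0 = solve-∀ ℚ-ring
  kernel : ∀ y → φ (c y ∷ᵥ y) ≡ 0ℚ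
  kernel y = trans (∷ᵥ-split φ-lin (c y) y)
                   (cancel (φ (0ℚ ∷ᵥ y)) (recip (φ e₀)) (φ e₀) (p*recip[p]≡1 φe₀≢0))
kernel-embedding {zero} {φ} φ-lin | yes _ = record
  { ι = λ _ → 0ₚ
  ; ι-linear = λ _ → zero-linear
  ; ι-kernel = λ _ → zero-hom φ-lin
  ; ι-nonzero = λ { _ (() , _) }
  }
kernel-embedding {suc k} {φ} φ-lin | yes φe₀≡0 = record
  { ι = λ y → head y ∷ᵥ E.ι (tail y)
  ; ι-linear = λ { zero → coordinate-linear zero ; (suc j) → linear-∘ (E.ι-linear j) tail-linear }
  ; ι-kernel = kernel
  ; ι-nonzero = nonzero
  }
  where
  module E = KernelEmbedding (kernel-embedding (linear-∘ φ-lin 0∷ᵥ-linear))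
  kernel : ∀ y → φ (head y ∷ᵥ E.ι (tail y)) ≡ 0ℚ
  kernel y = begin
    φ (head y ∷ᵥ E.ι (tail y))                     ≡⟨ ∷ᵥ-split φ-lin (head y) (E.ι (tail y)) ⟩
    φ (0ℚ ∷ᵥ E.ι (tail y)) + head y * φ e₀        ≡⟨ cong₂ (λ a e → a + head y * e) (E.ι-kernel (tail y)) φe₀≡0 ⟩
    0ℚ + head y * 0ℚ                               ≡⟨ 0+s*0≡0 (head y) ⟩
    0ℚ                                             ∎
    where
    open ≡-Reasoning
    0+s*0≡0 : ∀ s → 0ℚ + s * 0ℚ ≡ 0ℚ
    0+s*0≡0 = solve-∀ ℚ-ring
  nonzero : ∀ y → Nonzero y → Nonzero (head y ∷ᵥ E.ι (tail y))
  nonzero y (zero , y₀≢0) = zero , y₀≢0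
  nonzero y (suc j , yj≢0) with E.ι-nonzero (tail y) (j , yj≢0)
  ... | j′ , ≢0 = suc j′ , ≢0

record CommonRoot {m n} (F : Fin m → Point n → ℚ) : Set where
  field
    root : Point n
    root-nonzero : Nonzero root
    root-vanishes : ∀ r → F r root ≡ 0ℚ

nonzero-common-root : ∀ {m n} → m ℕ.< n → (F : Fin m → Point n → ℚ) → (∀ r → Linear (F r)) → CommonRoot F
nonzero-common-root {zero} {suc n} _ F _ = record
  { root = λ _ → 1ℚ ; root-nonzero = zero , 1≢0 ; root-vanishes = λ () }
nonzero-common-root {suc m} {suc n} (s≤s m<n) F F-linear = record
  { root = E.ι R.root
  ; root-nonzero = E.ι-nonzero R.root R.root-nonzero
  ; root-vanishes = λ { zero → E.ι-kernel R.root ; (suc r) → R.root-vanishes r }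
  }
  where
  module E = KernelEmbedding (kernel-embedding (F-linear zero))
  module R = CommonRoot (nonzero-common-root m<n (λ r → F (suc r) ∘ E.ι)
                                               (λ r → linear-∘ (F-linear (suc r)) E.ι-linear))

record CommonRootExcept {n} (F : Fin n → Point n → ℚ) (i : Fin n) : Set where
  field
    root : Point n
    root-nonzero : Nonzero root
    root-vanishes : ∀ j → j ≢ i → F j root ≡ 0ℚ

nonzero-common-root-except : ∀ {n} (F : Fin n → Point n → ℚ) → (∀ r → Linear (F r)) → ∀ i → CommonRootExcept F i
nonzero-common-root-except {suc n} F F-linear i = record
  { root = R.root ; root-nonzero = R.root-nonzero ; root-vanishes = vanishes }
  where
  module R = CommonRoot (nonzero-common-root (ℕ.n<1+n n) (F ∘ punchIn i) (F-linear ∘ punchIn i))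
  vanishes : ∀ j → j ≢ i → F j R.root ≡ 0ℚ
  vanishes j j≢i = subst (λ l → F l R.root ≡ 0ℚ) (Fin.punchIn-punchOut (j≢i ∘ sym))
                         (R.root-vanishes (punchOut (j≢i ∘ sym)))

Σℚ-cong : ∀ {k} {g h : Fin k → ℚ} → (∀ j → g j ≡ h j) → Σℚ g ≡ Σℚ h
Σℚ-cong {zero} _ = refl
Σℚ-cong {suc k} g≗h = cong₂ _+_ (g≗h zero) (Σℚ-cong (g≗h ∘ suc))

Σℚ-zero : ∀ {k} {g : Fin k → ℚ} → (∀ j → g j ≡ 0ℚ) → Σℚ g ≡ 0ℚ
Σℚ-zero {zero} _ = refl
Σℚ-zero {suc k} g≗0 = cong₂ _+_ (g≗0 zero) (Σℚ-zero (g≗0 ∘ suc))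

Σℚ-linear : ∀ {k} → Linear (Σℚ {k})
Σℚ-linear = record { shift-hom = hom ; resp-≈ = Σℚ-cong }
  where
  hom : ∀ {k} x t d → Σℚ {k} (shift x t d) ≡ Σℚ x + t * Σℚ d
  hom {zero} _ t _ = sym (0+t*0≡0 t)
    where
    0+t*0≡0 : ∀ t → 0ℚ + t * 0ℚ ≡ 0ℚ
    0+t*0≡0 = solve-∀ ℚ-ring
  hom {suc k} x t d = trans (cong (shift x t d zero +_) (hom (tail x) t (tail d)))
                            (interchange (x zero) (d zero) (Σℚ (tail x)) (Σℚ (tail d)) t)
    where
    interchange : ∀ a b c e t → (a + t * b) + (c + t * e) ≡ (a + c) + t * (b + e)
    interchange = solve-∀ ℚ-ring

weight-linear : ∀ {k} (w : Point k) → LinearMap (λ (c : Point k) j → c j * w j)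
weight-linear w j = record
  { shift-hom = λ x t d → distrib (x j) (d j) t (w j)
  ; resp-≈ = λ x≈y → cong (_* w j) (x≈y j)
  }
  where
  distrib : ∀ a b t q → (a + t * b) * q ≡ a * q + t * (b * q)
  distrib = solve-∀ ℚ-ring

unit : ∀ {n} → Fin n → Point n
unit zero zero = 1ℚ
unit zero (suc _) = 0ℚ
unit (suc _) zero = 0ℚ
unit (suc i) (suc j) = unit i j

unit-diagonal : ∀ {n} (i : Fin n) → unit i i ≡ 1ℚ
unit-diagonal zero = refl
unit-diagonal (suc i) = unit-diagonal i

unit-offDiagonal : ∀ {n} {i j : Fin n} → i ≢ j → unit i j ≡ 0ℚ
unit-offDiagonal {i = zero} {zero} i≢j = contradiction refl i≢j
unit-offDiagonal {i = zero} {suc j} _ = refl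
unit-offDiagonal {i = suc i} {zero} _ = refl
unit-offDiagonal {i = suc i} {suc j} i≢j = unit-offDiagonal (i≢j ∘ cong suc)

unit-nonNeg : ∀ {n} (i j : Fin n) → 0ℚ ≤ unit i j
unit-nonNeg zero zero = *≤* (ℤ.+≤+ ℕ.z≤n)
unit-nonNeg zero (suc j) = ≤-refl
unit-nonNeg (suc i) zero = ≤-refl
unit-nonNeg (suc i) (suc j) = unit-nonNeg i j

unit-≤1 : ∀ {n} (i j : Fin n) → unit i j ≤ 1ℚ
unit-≤1 zero zero = ≤-refl
unit-≤1 zero (suc j) = *≤* (ℤ.+≤+ ℕ.z≤n)
unit-≤1 (suc i) zero = *≤* (ℤ.+≤+ ℕ.z≤n)
unit-≤1 (suc i) (suc j) = unit-≤1 i j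

Σℚ-unit : ∀ {n} (g : Point n) i → Σℚ (λ j → g j * unit j i) ≡ g i
Σℚ-unit g zero = trans (cong₂ _+_ (*-identityʳ (g zero)) (Σℚ-zero (λ j → *-zeroʳ (g (suc j)))))
                       (+-identityʳ (g zero))
Σℚ-unit g (suc i) = trans (cong₂ _+_ (*-zeroʳ (g zero)) (Σℚ-unit (tail g) i)) (+-identityˡ (g (suc i)))

simplex : ∀ {n} → Fin (suc n) → Point n
simplex zero = 0ₚ
simplex (suc i) = unit i

simplex-affIndep : ∀ {n} → AffIndep (simplex {n})
simplex-affIndep c Σc≡0 moments≡0 = vanish
  where
  moment : ∀ i → Σℚ (λ j → c j * simplex j i) ≡ c (suc i)
  moment i = trans (cong (_+ Σℚ (λ j → c (suc j) * unit j i)) (*-zeroʳ (c zero)))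
                   (trans (+-identityˡ _) (Σℚ-unit (tail c) i))
  vanish : ∀ j → c j ≡ 0ℚ
  vanish (suc i) = trans (sym (moment i)) (moments≡0 i)
  vanish zero = begin
    c zero                    ≡⟨ +-identityʳ (c zero) ⟨
    c zero + 0ℚ               ≡⟨ cong (c zero +_) (Σℚ-zero (vanish ∘ suc)) ⟨
    c zero + Σℚ (tail c)      ≡⟨ Σc≡0 ⟩
    0ℚ                        ∎
    where open ≡-Reasoning

-- n + 2 points in ℚⁿ: the n + 1 linear conditions defining AffIndep have a nonzero common root.
affine-dependent : ∀ {n} (p : Fin (suc (suc n)) → Point n) → ¬ AffIndep p
affine-dependent {n} p indep =
  let j , root[j]≢0 = R.root-nonzero
  in root[j]≢0 (indep R.root (R.root-vanishes zero) (R.root-vanishes ∘ suc) j)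
  where
  conditions : Fin (suc n) → Point (suc (suc n)) → ℚ
  conditions zero = Σℚ
  conditions (suc i) c = Σℚ (λ j → c j * p j i)
  conditions-linear : ∀ r → Linear (conditions r)
  conditions-linear zero = Σℚ-linear
  conditions-linear (suc i) = linear-∘ Σℚ-linear (weight-linear (λ j → p j i))
  module R = CommonRoot (nonzero-common-root ℕ.≤-refl conditions conditions-linear)

hasDim-of-simplex : ∀ {n} (P : Point n → Set) → (∀ j → P (simplex j)) → HasDim P n
hasDim-of-simplex P simplex∈P = (simplex , simplex∈P , simplex-affIndep) , λ p _ → affine-dependent p

module _ {n : ℕ} where

  sumOver-++ : ∀ (xs ys : List (Fin n)) x → sumOver (xs ++ ys) x ≡ sumOver xs x + sumOver ys x
  sumOver-++ [] ys x = sym (+-identityˡ _)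
  sumOver-++ (a ∷ xs) ys x = trans (cong (x a +_) (sumOver-++ xs ys x)) (sym (+-assoc (x a) _ _))

  sumOver-linear : ∀ (L : List (Fin n)) → Linear (sumOver L)
  sumOver-linear L = record { shift-hom = hom L ; resp-≈ = λ x≈y → cong-sum L x≈y }
    where
    cong-sum : ∀ L {x y : Point n} → x ≈ₚ y → sumOver L x ≡ sumOver L y
    cong-sum [] _ = refl
    cong-sum (a ∷ L) x≈y = cong₂ _+_ (x≈y a) (cong-sum L x≈y)
    hom : ∀ L x t d → sumOver L (shift x t d) ≡ sumOver L x + t * sumOver L d
    hom [] x t d = sym (0+t*0≡0 t)
      where
      0+t*0≡0 : ∀ t → 0ℚ + t * 0ℚ ≡ 0ℚ
      0+t*0≡0 = solve-∀ ℚ-ring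
    hom (a ∷ L) x t d = trans (cong (shift x t d a +_) (hom L x t d))
                              (interchange (x a) (d a) (sumOver L x) (sumOver L d) t)
      where
      interchange : ∀ a b c e t → (a + t * b) + (c + t * e) ≡ (a + c) + t * (b + e)
      interchange = solve-∀ ℚ-ring

  sumOver-nonNeg : ∀ (L : List (Fin n)) {x} → (∀ j → 0ℚ ≤ x j) → 0ℚ ≤ sumOver L x
  sumOver-nonNeg [] _ = ≤-refl
  sumOver-nonNeg (a ∷ L) x≥0 = +-mono-≤ (x≥0 a) (sumOver-nonNeg L x≥0)

  x≤sumOver : ∀ {L : List (Fin n)} {x i} → (∀ j → 0ℚ ≤ x j) → i ∈ L → x i ≤ sumOver L x
  x≤sumOver {a ∷ L} {x} x≥0 (here refl) = ≤-by-gap (sumOver L x) refl (sumOver-nonNeg L x≥0)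
  x≤sumOver {a ∷ L} {x} x≥0 (there i∈L) =
    ≤-trans (x≤sumOver x≥0 i∈L) (≤-by-gap (x a) (+-comm (x a) (sumOver L x)) (x≥0 a))

  sumOver-pos : ∀ (L : List (Fin n)) {x} → 0ℚ < sumOver L x → ∃ λ j → j ∈ L × 0ℚ < x j
  sumOver-pos [] 0<0 = contradiction 0<0 (<-irrefl refl)
  sumOver-pos (a ∷ L) {x} 0<sum with 0ℚ <? x a
  ... | yes 0<xa = a , here refl , 0<xa
  ... | no 0≮xa =
    let j , j∈L , 0<xj = sumOver-pos L {x} (<-≤-trans 0<sum drop-head)
    in j , there j∈L , 0<xj
    where
    drop-head : x a + sumOver L x ≤ sumOver L x
    drop-head = subst (x a + sumOver L x ≤_) (+-identityˡ (sumOver L x)) (+-monoˡ-≤ (sumOver L x) (≮⇒≥ 0≮xa))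

  sumOver-≤-length : ∀ (L : List (Fin n)) {x} → (∀ j → x j ≤ 1ℚ) → sumOver L x ≤ ℕ→ℚ (length L)
  sumOver-≤-length [] _ = ≤-refl
  sumOver-≤-length (a ∷ L) {x} x≤1 = subst (x a + sumOver L x ≤_) (sym (ℤ→ℚ-homo-+ (ℤ.+ 1) (ℤ.+ length L)))
                                       (+-mono-≤ (x≤1 a) (sumOver-≤-length L x≤1))

  sumOver-zero : ∀ {L : List (Fin n)} {x} → (∀ j → j ∈ L → x j ≡ 0ℚ) → sumOver L x ≡ 0ℚ
  sumOver-zero {[]} _ = refl
  sumOver-zero {a ∷ L} x≡0 = cong₂ _+_ (x≡0 a (here refl)) (sumOver-zero (λ j → x≡0 j ∘ there))

  sumOver-single : ∀ {L : List (Fin n)} {x i} → Unique L → i ∈ L → (∀ j → j ∈ L → j ≢ i → x j ≡ 0ℚ)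
                 → sumOver L x ≡ x i
  sumOver-single {a ∷ L} {x} (a∉L ∷ _) (here refl) others≡0 =
    trans (cong (x a +_) (sumOver-zero λ j j∈L → others≡0 j (there j∈L) (All.lookup a∉L j∈L ∘ sym)))
          (+-identityʳ (x a))
  sumOver-single {a ∷ L} {x} (a∉L ∷ unique) (there i∈L) others≡0 =
    trans (cong₂ _+_ (others≡0 a (here refl) (All.lookup a∉L i∈L))
                     (sumOver-single unique i∈L (λ j → others≡0 j ∘ there)))
          (+-identityˡ _)

  ℕ→ℚ-length-++ : ∀ (xs : List (Fin n)) {ys} → ℕ→ℚ (length (xs ++ ys)) ≡ ℕ→ℚ (length xs) + ℕ→ℚ (length ys)
  ℕ→ℚ-length-++ xs {ys} = trans (cong ℕ→ℚ (length-++ xs)) (ℤ→ℚ-homo-+ (ℤ.+ length xs) (ℤ.+ length ys))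

  sumOver-integral : ∀ {L : List (Fin n)} {x} → (∀ j → j ∈ L → Integral (x j)) → Integral (sumOver L x)
  sumOver-integral {[]} _ = ℕ→ℚ-integral 0
  sumOver-integral {a ∷ L} integral = integral-+ (integral a (here refl)) (sumOver-integral (λ j → integral j ∘ there))

-- Polyhedra

≤-totalOrder : TotalOrder 0ℓ 0ℓ 0ℓ
≤-totalOrder = record { isTotalOrder = ≤-isTotalOrder }

open Extrema ≤-totalOrder using (argmin; min; argmin-all; f[argmin]≤f[xs]; min≤xs)

module Polyhedron
  {n : ℕ} {K : Set} (_≟ᴷ_ : DecidableEquality K)
  (constraints : List K) (∈-constraints : ∀ k → k ∈ constraints)
  (f : K → Point n → ℚ) (f-linear : ∀ k → Linear (f k)) (b : K → ℚ)
  (P : Point n → Set) (P⇔ : ∀ x → P x ⇔ (∀ k → f k x ≤ b k))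
  where

  satisfies : ∀ {x} → P x → ∀ k → f k x ≤ b k
  satisfies {x} = Equivalence.to (P⇔ x)

  P-intro : ∀ {x} → (∀ k → f k x ≤ b k) → P x
  P-intro {x} = Equivalence.from (P⇔ x)

  f-shift : ∀ k x t d → f k (shift x t d) ≡ f k x + t * f k d
  f-shift k = shift-hom (f-linear k)

  Active : Point n → K → Set
  Active x k = f k x ≡ b k

  Tangent : Point n → Point n → Set
  Tangent x d = ∀ k → Active x k → f k d ≡ 0ℚ

  TangentExcept : Point n → K → Point n → Set
  TangentExcept x k₀ d = ∀ k → k ≢ k₀ → Active x k → f k d ≡ 0ℚ

  Basic : Point n → Set
  Basic x = ∀ y → (∀ k → Active x k → Active y k) → y ≈ₚ x

  active-comb : ∀ {y z l k} → P y → P z → 0ℚ < l → l < 1ℚ → Active (comb l y z) k → Active y k × Active z k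
  active-comb {y} {z} {l} {k} y∈P z∈P 0<l l<1 active =
    comb-attains-bound 0<l l<1 (satisfies y∈P k) (satisfies z∈P k) (trans (sym (comb-hom (f-linear k) l y z)) active)

  active-segment : ∀ {u w k} μ → Active u k → Active w k → Active (comb μ u w) k
  active-segment {u} {w} {k} μ u-active w-active = begin
    f k (comb μ u w)                 ≡⟨ comb-hom (f-linear k) μ u w ⟩
    μ * f k u + (1ℚ - μ) * f k w     ≡⟨ cong₂ (λ p q → μ * p + (1ℚ - μ) * q) u-active w-active ⟩
    μ * b k + (1ℚ - μ) * b k         ≡⟨ comb-same μ (b k) ⟩
    b k                              ∎
    where
    open ≡-Reasoning
    comb-same : ∀ μ B → μ * B + (1ℚ - μ) * B ≡ B
    comb-same = solve-∀ ℚ-ring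

  basic-tangent-zero : ∀ {x d} → Basic x → Tangent x d → ∀ j → d j ≡ 0ℚ
  basic-tangent-zero {x} {d} basic tangent j = cancel (x j) (d j) (basic (shift x 1ℚ d) stays j)
    where
    stays : ∀ k → Active x k → Active (shift x 1ℚ d) k
    stays k active = trans (shift-kernel (f-linear k) x 1ℚ (tangent k active)) active
    cancel : ∀ a c → a + 1ℚ * c ≡ a → c ≡ 0ℚ
    cancel a c a+c≡a = trans (c≡a+1*c-a a c) (trans (cong (_- a) a+c≡a) (+-inverseʳ a))
      where
      c≡a+1*c-a : ∀ a c → c ≡ (a + 1ℚ * c) - a
      c≡a+1*c-a = solve-∀ ℚ-ring

  basic-nonzero-not-tangent : ∀ {x d} → Basic x → Nonzero d → ¬ Tangent x d
  basic-nonzero-not-tangent basic (j , dj≢0) tangent = dj≢0 (basic-tangent-zero basic tangent j)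

  record FeasibleStep (x d : Point n) : Set where
    field
      ε : ℚ
      ε-pos : 0ℚ < ε
      feasible : ∀ s → 0ℚ ≤ s → s ≤ ε → P (shift x s d)

  feasible-step : ∀ {x d} → P x → Tangent x d → FeasibleStep x d
  feasible-step {x} {d} x∈P tangent = record
    { ε = δ
    ; ε-pos = argmin-all id {xs = map ε constraints} {P = 0ℚ <_} 0<1
                         (All-map⁺ (All.tabulate λ {k} _ → proj₁ (proj₂ (bound k))))
    ; feasible = λ s 0≤s s≤δ → P-intro λ k → within k s 0≤s (≤-trans s≤δ (δ≤ε k))
    }
    where
    bound : ∀ k → ∃ λ ε → 0ℚ < ε × ∀ s → 0ℚ ≤ s → s ≤ ε → f k x + s * f k d ≤ b k
    bound k = ray-below (satisfies x∈P k) (tangent k)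
    ε : K → ℚ
    ε = proj₁ ∘ bound
    δ : ℚ
    δ = min 1ℚ (map ε constraints)
    δ≤ε : ∀ k → δ ≤ ε k
    δ≤ε k = All.lookup (min≤xs 1ℚ (map ε constraints)) (∈-map⁺ ε (∈-constraints k))
    within : ∀ k s → 0ℚ ≤ s → s ≤ ε k → f k (shift x s d) ≤ b k
    within k s 0≤s s≤ε = subst (_≤ b k) (sym (f-shift k x s d)) (proj₂ (proj₂ (bound k)) s 0≤s s≤ε)

  active-difference : ∀ {x y k} → Active x k → Active y k → f k (y -ₚ x) ≡ 0ℚ
  active-difference {x} {y} {k} x-active y-active =
    trans (-ₚ-hom (f-linear k) y x) (trans (cong₂ _-_ y-active x-active) (+-inverseʳ (b k)))

  -- A vertex is the midpoint of x ± ε (y - x), so y - x must vanish.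
  vertex⇒basic : ∀ {x} → IsVertex P x → Basic x
  vertex⇒basic {x} (x∈P , extreme) y active⊆ j = begin
    y j                ≡⟨ y≡x+d (y j) (x j) ⟩
    x j + d j          ≡⟨ cong (x j +_) (p*q≡0⇒q≡0 (<⇒≢ (+-mono-< 0<ε 0<ε) ∘ sym)
                                                   (two-steps-apart (x j) ε (d j) (opposite j))) ⟩
    x j + 0ℚ           ≡⟨ +-identityʳ (x j) ⟩
    x j                ∎
    where
    open ≡-Reasoning
    d = y -ₚ x
    tangent : Tangent x d
    tangent k active = active-difference active (active⊆ k active)
    module F₊ = FeasibleStep (feasible-step x∈P tangent)
    module F₋ = FeasibleStep (feasible-step x∈P λ k → neg-kernel (f-linear k) ∘ tangent k)
    ε = F₊.ε ⊓ F₋.ε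
    0<ε : 0ℚ < ε
    0<ε = ⊓-pos F₊.ε-pos F₋.ε-pos
    midpoint : ∀ x e d → x ≡ ½ * (x + e * d) + (1ℚ - ½) * (x + e * (- d))
    midpoint = solve-∀ ℚ-ring
    opposite : shift x ε d ≈ₚ shift x ε (negₚ d)
    opposite = extreme _ _ ½ (F₊.feasible ε (<⇒≤ 0<ε) (p⊓q≤p F₊.ε F₋.ε))
                             (F₋.feasible ε (<⇒≤ 0<ε) (p⊓q≤q F₊.ε F₋.ε))
                             0<½ ½<1 (λ i → midpoint (x i) ε (d i))
    two-steps-apart : ∀ a e c → a + e * c ≡ a + e * (- c) → (e + e) * c ≡ 0ℚ
    two-steps-apart a e c same = trans (difference a e c) (trans (cong (_- (a + e * (- c))) same) (+-inverseʳ (a + e * (- c))))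
      where
      difference : ∀ a e c → (e + e) * c ≡ (a + e * c) - (a + e * (- c))
      difference = solve-∀ ℚ-ring
    y≡x+d : ∀ y x → y ≡ x + (y - x)
    y≡x+d = solve-∀ ℚ-ring

  basic⇒vertex : ∀ {x} → P x → Basic x → IsVertex P x
  basic⇒vertex {x} x∈P basic = x∈P , λ y z l y∈P z∈P 0<l l<1 x≈comb →
    let both : ∀ k → Active x k → Active y k × Active z k
        both k active = active-comb y∈P z∈P 0<l l<1 (trans (resp-≈ (f-linear k) (sym ∘ x≈comb)) active)
    in λ i → trans (basic y (λ k → proj₁ ∘ both k) i) (sym (basic z (λ k → proj₂ ∘ both k) i))

  vertex-on-segment : ∀ {u w p} → P u → P w → IsVertex P p → InSeg u w p → p ≈ₚ u ⊎ p ≈ₚ w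
  vertex-on-segment {u} {w} {p} u∈P w∈P (_ , extreme) (l , 0≤l , l≤1 , p≈comb) with l ≟ 0ℚ | l ≟ 1ℚ
  ... | yes refl | _ = inj₂ λ i → trans (p≈comb i) (at-0 (u i) (w i))
    where
    at-0 : ∀ u w → 0ℚ * u + (1ℚ - 0ℚ) * w ≡ w
    at-0 = solve-∀ ℚ-ring
  ... | no _ | yes refl = inj₁ λ i → trans (p≈comb i) (at-1 (u i) (w i))
    where
    at-1 : ∀ u w → 1ℚ * u + (1ℚ - 1ℚ) * w ≡ u
    at-1 = solve-∀ ℚ-ring
  ... | no l≢0 | no l≢1 = inj₁ λ i →
    trans (p≈comb i) (trans (cong (λ c → l * u i + (1ℚ - l) * c) (sym (u≈w i))) (comb-same l (u i)))
    where
    u≈w = extreme u w l u∈P w∈P (≤∧≢⇒< 0≤l (l≢0 ∘ sym)) (≤∧≢⇒< l≤1 l≢1) p≈comb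
    comb-same : ∀ l u → l * u + (1ℚ - l) * u ≡ u
    comb-same = solve-∀ ℚ-ring

  -- Push y away from the midpoint m of the edge, to z = m + ε (m - y); then m is a proper
  -- convex combination of y and z, so the face property of the edge captures y.
  edge-face : ∀ {u w y} → IsEdge P u w → P y → (∀ k → Active u k → Active w k → Active y k) → InSeg u w y
  edge-face {u} {w} {y} ((u∈P , _) , (w∈P , _) , _ , face) y∈P active∩⊆ =
    proj₁ (face y z λ' y∈P (F.feasible F.ε (<⇒≤ F.ε-pos) ≤-refl) 0<λ' λ'<1 m∈[u,w])
    where
    m = comb ½ u w
    m∈P : P m
    m∈P = P-intro λ k → subst (_≤ b k) (sym (comb-hom (f-linear k) ½ u w))
                               (comb-≤-bound (<⇒≤ 0<½) (<⇒≤ ½<1) (satisfies u∈P k) (satisfies w∈P k))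
    m-active⊆ : ∀ k → Active m k → Active y k
    m-active⊆ k active = let u-active , w-active = active-comb u∈P w∈P 0<½ ½<1 active in active∩⊆ k u-active w-active
    module F = FeasibleStep (feasible-step m∈P λ k active → active-difference (m-active⊆ k active) active)
    z = shift m F.ε (m -ₚ y)
    1+ε≢0 : 1ℚ + F.ε ≢ 0ℚ
    1+ε≢0 = <⇒≢ (+-mono-<-≤ 0<1 (<⇒≤ F.ε-pos)) ∘ sym
    λ' = F.ε * recip (1ℚ + F.ε)
    0<λ' : 0ℚ < λ'
    0<λ' = pos*pos F.ε-pos (recip-pos (+-mono-<-≤ 0<1 (<⇒≤ F.ε-pos)))
    λ'<1 : λ' < 1ℚ
    λ'<1 = <-by-gap (recip (1ℚ + F.ε)) (sym (trans (sum F.ε (recip (1ℚ + F.ε))) (p*recip[p]≡1 1+ε≢0)))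
                    (recip-pos (+-mono-<-≤ 0<1 (<⇒≤ F.ε-pos)))
      where
      sum : ∀ e r → e * r + r ≡ (1ℚ + e) * r
      sum = solve-∀ ℚ-ring
    m∈[u,w] : InSeg u w (comb λ' y z)
    m∈[u,w] = ½ , <⇒≤ 0<½ , <⇒≤ ½<1 , λ i → trans (rearrange (y i) (m i) F.ε (recip (1ℚ + F.ε)))
                 (trans (cong (λ c → m i + (c - 1ℚ) * (F.ε * (y i - m i))) (p*recip[p]≡1 1+ε≢0))
                        (collapse (m i) (F.ε * (y i - m i))))
      where
      rearrange : ∀ y m e r → (e * r) * y + (1ℚ - e * r) * (m + e * (m - y)) ≡ m + ((1ℚ + e) * r - 1ℚ) * (e * (y - m))
      rearrange = solve-∀ ℚ-ring
      collapse : ∀ m a → m + (1ℚ - 1ℚ) * a ≡ m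
      collapse = solve-∀ ℚ-ring

  exists-dropped : ∀ {x y} → Basic x → ¬ (y ≈ₚ x) → ∃ λ k → Active x k × ¬ Active y k
  exists-dropped {x} {y} basic y≉x with any? (λ k → (f k x ≟ b k) ×-dec ¬? (f k y ≟ b k)) constraints
  ... | yes found = satisfied found
  ... | no none = contradiction (basic y λ k active → decidable-stable (f k y ≟ b k) λ inactive →
                                  none (lose (∈-constraints k) (active , inactive))) y≉x

  unbounded-direction : Bounded P → ∀ {x d} → P x → Nonzero d → ∃ λ k → 0ℚ < f k d
  unbounded-direction (M , bounded) {x} {d} x∈P (j , dj≢0) with any? (λ k → 0ℚ <? f k d) constraints
  ... | yes found = satisfied found
  ... | no none =
    let -M≤xj , xj≤M = bounded x x∈P j
        s , 0≤s , escapes = ray-escapes -M≤xj xj≤M dj≢0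
    in contradiction (bounded _ (ray-feasible s 0≤s) j) escapes
    where
    ray-feasible : ∀ s → 0ℚ ≤ s → P (shift x s d)
    ray-feasible s 0≤s = P-intro λ k → subst (_≤ b k) (sym (f-shift k x s d))
      (≤-trans (ray-nonIncreasing 0≤s (≮⇒≥ λ 0<fd → none (lose (∈-constraints k) 0<fd))) (satisfies x∈P k))

  record Adjacent (x : Point n) (k₀ : K) : Set where
    field
      neighbour : Point n
      edge : IsEdge P x neighbour
      keeps : ∀ k → k ≢ k₀ → Active x k → Active neighbour k
      drops : ¬ Active neighbour k₀

  -- Leave the face k₀ of the vertex x along d, up to the first constraint ahead.
  module Walk {x : Point n} (x∈P : P x) (basic : Basic x) {k₀ : K} (k₀-active : Active x k₀)
              {d : Point n} (tangent : TangentExcept x k₀ d) (leaves : f k₀ d < 0ℚ)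
              {k₁ : K} (k₁-ahead : 0ℚ < f k₁ d) where

    Ahead : K → Set
    Ahead k = 0ℚ < f k d

    ratio : K → ℚ
    ratio k = (b k - f k x) * recip (f k d)

    ahead-reached : ∀ k → Ahead k → ratio k * f k d ≡ b k - f k x
    ahead-reached k ahead = q*recip[p]*p≡q (b k - f k x) (<⇒≢ ahead ∘ sym)

    ahead-inactive : ∀ k → Ahead k → ¬ Active x k
    ahead-inactive k ahead active with k ≟ᴷ k₀
    ... | yes refl = <-asym leaves ahead
    ... | no k≢k₀ = <⇒≢ ahead (sym (tangent k k≢k₀ active))

    ahead-ratio-pos : ∀ k → Ahead k → 0ℚ < ratio k
    ahead-ratio-pos k ahead = pos*pos (p<q⇒0<q-p (≤∧≢⇒< (satisfies x∈P k) (ahead-inactive k ahead))) (recip-pos ahead)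

    blocking : K
    blocking = argmin ratio k₁ (filter (λ k → 0ℚ <? f k d) constraints)

    blocking-ahead : Ahead blocking
    blocking-ahead = argmin-all ratio {P = Ahead} k₁-ahead (all-filter (λ k → 0ℚ <? f k d) constraints)

    blocking-first : ∀ k → Ahead k → ratio blocking ≤ ratio k
    blocking-first k ahead = All.lookup (f[argmin]≤f[xs] k₁ (filter (λ k → 0ℚ <? f k d) constraints))
                                        (∈-filter⁺ (λ k → 0ℚ <? f k d) (∈-constraints k) ahead)

    t : ℚ
    t = ratio blocking

    w : Point n
    w = shift x t d

    w∈P : P w
    w∈P = P-intro λ k → subst (_≤ b k) (sym (f-shift k x t d))
      (ray-step-below (satisfies x∈P k) (<⇒≤ (ahead-ratio-pos blocking blocking-ahead)) λ ahead →
        subst (t * f k d ≤_) (ahead-reached k ahead)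
              (*-monoʳ-≤-nonNeg (f k d) {{nonNegative (<⇒≤ ahead)}} (blocking-first k ahead)))

    blocking-active : Active w blocking
    blocking-active = begin
      f blocking w                                         ≡⟨ f-shift blocking x t d ⟩
      f blocking x + t * f blocking d                      ≡⟨ cong (f blocking x +_) (ahead-reached blocking blocking-ahead) ⟩
      f blocking x + (b blocking - f blocking x)           ≡⟨ p+[q-p]≡q (f blocking x) (b blocking) ⟩
      b blocking                                           ∎
      where open ≡-Reasoning

    keeps : ∀ k → k ≢ k₀ → Active x k → Active w k
    keeps k k≢k₀ active = trans (shift-kernel (f-linear k) x t (tangent k k≢k₀ active)) active

    drops : ¬ Active w k₀
    drops active = <-irrefl (trans (sym (f-shift k₀ x t d)) (trans active (sym k₀-active)))
                            (ray-decreasing (ahead-ratio-pos blocking blocking-ahead) leaves)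

    on-line : ∀ {y} → (∀ k → k ≢ k₀ → Active x k → Active y k) → ∃ λ τ → y ≈ₚ shift x τ d
    on-line {y} active⊆ = - σ , λ i → back (y i) (x i) σ (d i) (basic z z-active i)
      where
      σ = (b k₀ - f k₀ y) * recip (f k₀ d)
      z = shift y σ d
      z-active : ∀ k → Active x k → Active z k
      z-active k active with k ≟ᴷ k₀
      ... | yes refl = trans (f-shift k₀ y σ d)
                             (trans (cong (f k₀ y +_) (q*recip[p]*p≡q (b k₀ - f k₀ y) (<⇒≢ leaves)))
                                    (p+[q-p]≡q (f k₀ y) (b k₀)))
      ... | no k≢k₀ = trans (shift-kernel (f-linear k) y σ (tangent k k≢k₀ active)) (active⊆ k k≢k₀ active)
      back : ∀ y x s d → y + s * d ≡ x → y ≡ x + (- s) * d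
      back y x s d y+sd≡x = trans (y≡y+sd-sd y s d) (cong (_+ (- s) * d) y+sd≡x)
        where
        y≡y+sd-sd : ∀ y s d → y ≡ (y + s * d) + (- s) * d
        y≡y+sd-sd = solve-∀ ℚ-ring

    along : ∀ {y} τ → y ≈ₚ shift x τ d → ∀ k → f k y ≡ f k x + τ * f k d
    along τ y≈ k = trans (resp-≈ (f-linear k) y≈) (f-shift k x τ d)

    w-basic : Basic w
    w-basic y active⊆ i = trans (y≈ i) (cong (λ σ → x i + σ * d i) τ≡t)
      where
      line = on-line (λ k k≢k₀ → active⊆ k ∘ keeps k k≢k₀)
      τ = proj₁ line
      y≈ = proj₂ line
      τ≡t : τ ≡ t
      τ≡t = ray-param-unique {f blocking x} (<⇒≢ blocking-ahead ∘ sym) (begin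
        f blocking x + τ * f blocking d   ≡⟨ along τ y≈ blocking ⟨
        f blocking y                      ≡⟨ active⊆ blocking blocking-active ⟩
        b blocking                        ≡⟨ blocking-active ⟨
        f blocking w                      ≡⟨ f-shift blocking x t d ⟩
        f blocking x + t * f blocking d   ∎)
        where open ≡-Reasoning

    face : ∀ {y} → P y → (∀ k → k ≢ k₀ → Active x k → Active y k) → InSeg x w y
    face {y} y∈P active⊆ =
      let l , 0≤l , l≤1 , on-segment = segment-param 0≤τ τ≤t (ahead-ratio-pos blocking blocking-ahead)
      in l , 0≤l , l≤1 , λ i → trans (y≈ i) (on-segment (x i) (d i))
      where
      line = on-line active⊆
      τ = proj₁ line
      y≈ = proj₂ line
      0≤τ : 0ℚ ≤ τ
      0≤τ = ray-param-nonNeg (subst₂ _≤_ (along τ y≈ k₀) (sym k₀-active) (satisfies y∈P k₀)) leaves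
      τ≤t : τ ≤ t
      τ≤t = ray-param-≤ {f blocking x} (subst₂ _≤_ (along τ y≈ blocking)
                                                   (trans (sym blocking-active) (f-shift blocking x t d))
                                                   (satisfies y∈P blocking))
                        blocking-ahead

    edge : IsEdge P x w
    edge = basic⇒vertex x∈P basic , basic⇒vertex w∈P w-basic , x≉w , segment-face
      where
      x≉w : ¬ (x ≈ₚ w)
      x≉w x≈w = drops (trans (sym (resp-≈ (f-linear k₀) x≈w)) k₀-active)
      segment-face : ∀ y z l → P y → P z → 0ℚ < l → l < 1ℚ → InSeg x w (comb l y z) → InSeg x w y × InSeg x w z
      segment-face y z l y∈P z∈P 0<l l<1 (μ , _ , _ , comb≈) = face y∈P (λ k k≢k₀ → proj₁ ∘ both k k≢k₀)
                                                              , face z∈P (λ k k≢k₀ → proj₂ ∘ both k k≢k₀)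
        where
        both : ∀ k → k ≢ k₀ → Active x k → Active y k × Active z k
        both k k≢k₀ active = active-comb y∈P z∈P 0<l l<1
          (trans (resp-≈ (f-linear k) comb≈) (active-segment μ active (keeps k k≢k₀ active)))

  adjacent : ∀ {x} → P x → Basic x → ∀ {k₀} → Active x k₀ → ∀ {d} → TangentExcept x k₀ d → f k₀ d < 0ℚ
           → ∀ {k₁} → 0ℚ < f k₁ d → Adjacent x k₀
  adjacent x∈P basic k₀-active tangent leaves k₁-ahead = record
    { neighbour = W.w ; edge = W.edge ; keeps = W.keeps ; drops = W.drops }
    where module W = Walk x∈P basic k₀-active tangent leaves k₁-ahead

  exit-direction : ∀ {x k₀ d} → Basic x → TangentExcept x k₀ d → Nonzero d
                 → ∃ λ d′ → TangentExcept x k₀ d′ × f k₀ d′ < 0ℚ × Nonzero d′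
  exit-direction {x} {k₀} {d} basic tangent nonzero with <-cmp (f k₀ d) 0ℚ
  ... | tri< leaves _ _ = d , tangent , leaves , nonzero
  ... | tri≈ _ f[k₀]d≡0 _ = contradiction full-tangent (basic-nonzero-not-tangent basic nonzero)
    where
    full-tangent : Tangent x d
    full-tangent k active with k ≟ᴷ k₀
    ... | yes refl = f[k₀]d≡0
    ... | no k≢k₀ = tangent k k≢k₀ active
  ... | tri> _ _ enters = negₚ d
                        , (λ k k≢k₀ → neg-kernel (f-linear k) ∘ tangent k k≢k₀)
                        , subst (_< 0ℚ) (sym (neg-hom (f-linear k₀) d)) (neg-antimono-< enters)
                        , negₚ-nonzero nonzero

  Covers : ∀ {m} → Point n → (Fin m → K) → Set
  Covers x g = ∀ k → Active x k → ∃ λ j → g j ≡ k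

  -- Dropping one of n covering constraints leaves, by linear algebra, a nonzero direction killing the
  -- other n - 1; at a basic point this direction must fail to be tangent.
  module Cover {x : Point n} (basic : Basic x) {g : Fin n → K} (covers : Covers x g) where

    module Dual (i : Fin n) = CommonRootExcept (nonzero-common-root-except (f ∘ g) (f-linear ∘ g) i)

    dual-tangentExcept : ∀ i → TangentExcept x (g i) (Dual.root i)
    dual-tangentExcept i k k≢gi active =
      let j , gj≡k = covers k active
      in subst (λ k → f k (Dual.root i) ≡ 0ℚ) gj≡k
               (Dual.root-vanishes i j λ j≡i → k≢gi (trans (sym gj≡k) (cong g j≡i)))

    cover-active : ∀ i → Active x (g i)
    cover-active i = decidable-stable (f (g i) x ≟ b (g i)) λ inactive →
      basic-nonzero-not-tangent basic (Dual.root-nonzero i) λ k active →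
        dual-tangentExcept i k (λ k≡gi → inactive (subst (Active x) k≡gi active)) active

    cover-injective : ∀ {i j} → g i ≡ g j → i ≡ j
    cover-injective {i} {j} gi≡gj = decidable-stable (i Fin.≟ j) λ i≢j →
      basic-nonzero-not-tangent basic (Dual.root-nonzero i) (tangent i≢j)
      where
      tangent : i ≢ j → Tangent x (Dual.root i)
      tangent i≢j k active with k ≟ᴷ g i
      ... | yes refl = trans (cong (λ k → f k (Dual.root i)) gi≡gj) (Dual.root-vanishes i j (i≢j ∘ sym))
      ... | no k≢gi = dual-tangentExcept i k k≢gi active

  module EdgesAt (bounded : Bounded P) {x : Point n} (x-vertex : IsVertex P x) {g : Fin n → K} (covers : Covers x g) where

    x∈P : P x
    x∈P = proj₁ x-vertex

    basic : Basic x
    basic = vertex⇒basic x-vertex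

    open Cover basic covers

    adjacent-along : ∀ i → Adjacent x (g i)
    adjacent-along i =
      let d , tangent , leaves , nonzero = exit-direction basic (dual-tangentExcept i) (Dual.root-nonzero i)
          _ , ahead = unbounded-direction bounded x∈P nonzero
      in adjacent x∈P basic (cover-active i) tangent leaves ahead

    open module Along i = Adjacent (adjacent-along i) public

    distinct : ∀ i j → neighbour i ≈ₚ neighbour j → i ≡ j
    distinct i j same = cover-injective (decidable-stable (g i ≟ᴷ g j) λ gi≢gj →
      drops i (trans (resp-≈ (f-linear (g i)) same) (keeps j (g i) gi≢gj (cover-active i))))

    -- An edge [x , w] drops some active constraint g i; the neighbour along g i keeps every other
    -- constraint active at x, so it lies on [x , w], and being a vertex other than x it is w.
    complete : ∀ w → IsEdge P x w → ∃ λ j → w ≈ₚ neighbour j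
    complete w w-edge@(_ , (w∈P , _) , x≉w , _) =
      let k , k-active , k-inactive = exists-dropped basic (λ w≈x → x≉w (sym ∘ w≈x))
          i , gi≡k = covers k k-active
          on-edge : InSeg x w (neighbour i)
          on-edge = edge-face w-edge (proj₁ (proj₁ (proj₂ (edge i)))) λ k′ x-active w-active →
            keeps i k′ (λ k′≡gi → k-inactive (subst (Active w) (trans k′≡gi gi≡k) w-active)) x-active
      in endpoint i (vertex-on-segment x∈P w∈P (proj₁ (proj₂ (edge i))) on-edge)
      where
      endpoint : ∀ i → neighbour i ≈ₚ x ⊎ neighbour i ≈ₚ w → ∃ λ j → w ≈ₚ neighbour j
      endpoint i (inj₁ at-x) = contradiction (trans (resp-≈ (f-linear (g i)) at-x) (cover-active i)) (drops i)
      endpoint i (inj₂ at-w) = i , sym ∘ at-w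

  simple : Bounded P → HasDim P n → (∀ x → IsVertex P x → Σ (Fin n → K) (Covers x)) → IsSimple P
  simple bounded dim cover = n , dim , λ x x-vertex →
    let g , covers = cover x x-vertex
        open EdgesAt bounded x-vertex covers
    in neighbour , edge , distinct , complete

-- Arbors

module _ {A : Set} where

  concatMap-++ : ∀ {B : Set} (h : A → List B) xs ys → concatMap h (xs ++ ys) ≡ concatMap h xs ++ concatMap h ys
  concatMap-++ h xs ys = trans (cong concat (map-++ h xs ys)) (sym (concat-++ (map h xs) (map h ys)))

  Unique-++⁻ˡ : ∀ (xs : List A) {ys} → Unique (xs ++ ys) → Unique xs
  Unique-++⁻ˡ [] _ = []
  Unique-++⁻ˡ (x ∷ xs) (x∉ ∷ unique) = ++⁻ˡ xs x∉ ∷ Unique-++⁻ˡ xs unique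

  Unique-++⁻ʳ : ∀ (xs : List A) {ys} → Unique (xs ++ ys) → Unique ys
  Unique-++⁻ʳ [] unique = unique
  Unique-++⁻ʳ (x ∷ xs) (_ ∷ unique) = Unique-++⁻ʳ xs unique

  Unique-++-disjoint : ∀ (xs : List A) {ys a} → Unique (xs ++ ys) → a ∈ xs → a ∉ ys
  Unique-++-disjoint (x ∷ xs) (x∉ ∷ _) (here refl) a∈ys = All.lookup x∉ (∈-++⁺ʳ xs a∈ys) refl
  Unique-++-disjoint (x ∷ xs) (_ ∷ unique) (there a∈xs) = Unique-++-disjoint xs unique a∈xs

module _ {n : ℕ} where

  descLabels≡concat : ∀ (s : Tree n) → descLabels s ≡ concatMap label (subtrees s)
  descLabelsF≡concat : ∀ (cs : List (Tree n)) → descLabelsF cs ≡ concatMap label (subtreesF cs)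
  descLabels≡concat (node l cs) = cong (l ++_) (descLabelsF≡concat cs)
  descLabelsF≡concat [] = refl
  descLabelsF≡concat (c ∷ cs) = trans (cong₂ _++_ (descLabels≡concat c) (descLabelsF≡concat cs))
                                      (sym (concatMap-++ label (subtrees c) (subtreesF cs)))

  ∈-descLabels⁻ : ∀ (s : Tree n) {i} → i ∈ descLabels s → Any (λ v → i ∈ label v) (subtrees s)
  ∈-descLabels⁻ s i∈ = ∈-concatMap⁻ label (subst (_ ∈_) (descLabels≡concat s) i∈)

  self∈subtrees : ∀ (s : Tree n) → s ∈ subtrees s
  self∈subtrees (node _ _) = here refl

  subtrees-trans : ∀ (s : Tree n) {u v} → u ∈ subtrees s → v ∈ subtrees u → v ∈ subtrees s
  subtreesF-trans : ∀ (cs : List (Tree n)) {u v} → u ∈ subtreesF cs → v ∈ subtrees u → v ∈ subtreesF cs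
  subtrees-trans (node l cs) (here refl) v∈ = v∈
  subtrees-trans (node l cs) (there u∈) v∈ = there (subtreesF-trans cs u∈ v∈)
  subtreesF-trans (c ∷ cs) u∈ v∈ with ∈-++⁻ (subtrees c) u∈
  ... | inj₁ u∈c = ∈-++⁺ˡ (subtrees-trans c u∈c v∈)
  ... | inj₂ u∈cs = ∈-++⁺ʳ (subtrees c) (subtreesF-trans cs u∈cs v∈)

  child∈subtrees : ∀ {t : Tree n} {l cs c} → node l cs ∈ subtrees t → c ∈ cs → c ∈ subtrees t
  child∈subtrees {t} s∈ c∈cs = subtrees-trans t s∈ (there (child∈subtreesF c∈cs))
    where
    child∈subtreesF : ∀ {c : Tree n} {cs} → c ∈ cs → c ∈ subtreesF cs
    child∈subtreesF {cs = c ∷ cs} (here refl) = ∈-++⁺ˡ (self∈subtrees c)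
    child∈subtreesF {cs = c ∷ cs} (there c∈cs) = ∈-++⁺ʳ (subtrees c) (child∈subtreesF c∈cs)

  label-position-unique : ∀ (vs : List (Tree n)) → Unique (concatMap label vs)
                        → ∀ {p q i} → i ∈ label (lookup vs p) → i ∈ label (lookup vs q) → p ≡ q
  label-position-unique (v ∷ vs) unique {Fin.zero} {Fin.zero} _ _ = refl
  label-position-unique (v ∷ vs) unique {Fin.zero} {Fin.suc q} i∈v i∈ =
    contradiction (∈-concatMap⁺ label (lose (∈-lookup {xs = vs} q) i∈)) (Unique-++-disjoint (label v) unique i∈v)
  label-position-unique (v ∷ vs) unique {Fin.suc p} {Fin.zero} i∈ i∈v =
    contradiction (∈-concatMap⁺ label (lose (∈-lookup {xs = vs} p) i∈)) (Unique-++-disjoint (label v) unique i∈v)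
  label-position-unique (v ∷ vs) unique {Fin.suc p} {Fin.suc q} i∈p i∈q =
    cong Fin.suc (label-position-unique vs (Unique-++⁻ʳ (label v) unique) i∈p i∈q)

module _ {n : ℕ} (t : Tree n) where

  unit-cube⊆Q : ∀ {x} → (∀ j → 0ℚ ≤ x j) → (∀ j → x j ≤ 1ℚ) → Q t x
  unit-cube⊆Q 0≤x x≤1 = 0≤x , All.tabulate λ {v} _ → sumOver-≤-length (descLabels v) x≤1

  children-bound : ∀ {x cs} → Q t x → (∀ {c} → c ∈ cs → c ∈ subtrees t)
                 → sumOver (descLabelsF cs) x ≤ ℕ→ℚ (length (descLabelsF cs))
  children-bound {cs = []} _ _ = ≤-refl
  children-bound {x} {c ∷ cs} x∈Q cs⊆ =
    subst₂ _≤_ (sym (sumOver-++ (descLabels c) (descLabelsF cs) x)) (sym (ℕ→ℚ-length-++ (descLabels c)))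
               (+-mono-≤ (All.lookup (proj₂ x∈Q) (cs⊆ (here refl))) (children-bound x∈Q (cs⊆ ∘ there)))

  -- The children of an active vertex absorb at most their own size, so its label carries the rest.
  active⇒positive-label : ∀ {x s} → Q t x → s ∈ subtrees t → NonEmpty (label s)
                        → sumOver (descLabels s) x ≡ ℕ→ℚ (length (descLabels s))
                        → ∃ λ i → i ∈ label s × 0ℚ < x i
  active⇒positive-label {x} {node [] cs} _ _ nonEmpty _ = contradiction refl nonEmpty
  active⇒positive-label {x} {node l@(a ∷ l′) cs} x∈Q s∈ _ active = sumOver-pos l (<-≤-trans 0<|l| |l|≤sum)
    where
    0<|l| : 0ℚ < ℕ→ℚ (length l)
    0<|l| = <-≤-trans 0<1 (1≤ℕ→ℚ-suc (length l′))
    split : sumOver l x + sumOver (descLabelsF cs) x ≡ ℕ→ℚ (length l) + ℕ→ℚ (length (descLabelsF cs))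
    split = trans (sym (sumOver-++ l (descLabelsF cs) x))
                  (trans active (ℕ→ℚ-length-++ l))
    |l|≤sum : ℕ→ℚ (length l) ≤ sumOver l x
    |l|≤sum = +-cancelʳ-≤ (subst (_≤ sumOver l x + ℕ→ℚ (length (descLabelsF cs))) split
                                 (+-monoʳ-≤ (sumOver l x) (children-bound x∈Q (child∈subtrees s∈))))

module Arbor {n : ℕ} (t : Tree n) (arbor : IsArbor t) where

  m : ℕ
  m = length (subtrees t)

  vertex : Fin m → Tree n
  vertex = lookup (subtrees t)

  -- Constraint inj₁ i is x i ≥ 0, and inj₂ p is the inequality of the p-th vertex of t.
  Constraint : Set
  Constraint = Fin n ⊎ Fin m

  f : Constraint → Point n → ℚ
  f (inj₁ i) x = - x i
  f (inj₂ p) x = sumOver (descLabels (vertex p)) x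

  b : Constraint → ℚ
  b (inj₁ _) = 0ℚ
  b (inj₂ p) = ℕ→ℚ (length (descLabels (vertex p)))

  constraints : List Constraint
  constraints = map inj₁ (allFin n) ++ map inj₂ (allFin m)

  ∈-constraints : ∀ k → k ∈ constraints
  ∈-constraints (inj₁ i) = ∈-++⁺ˡ (∈-map⁺ inj₁ (∈-allFin i))
  ∈-constraints (inj₂ p) = ∈-++⁺ʳ (map inj₁ (allFin n)) (∈-map⁺ inj₂ (∈-allFin p))

  f-linear : ∀ k → Linear (f k)
  f-linear (inj₁ i) = record
    { shift-hom = λ x s d → neg-distrib (x i) s (d i) ; resp-≈ = λ x≈y → cong -_ (x≈y i) }
    where
    neg-distrib : ∀ a s c → - (a + s * c) ≡ - a + s * - c
    neg-distrib = solve-∀ ℚ-ring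
  f-linear (inj₂ p) = sumOver-linear (descLabels (vertex p))

  Q⇔constraints : ∀ x → Q t x ⇔ (∀ k → f k x ≤ b k)
  Q⇔constraints x = mk⇔ to from
    where
    to : Q t x → ∀ k → f k x ≤ b k
    to (0≤x , _) (inj₁ i) = neg-antimono-≤ (0≤x i)
    to (_ , bounds) (inj₂ p) = All.lookup bounds (∈-lookup p)
    from : (∀ k → f k x ≤ b k) → Q t x
    from sat = (λ i → -p≤0⇒0≤p (sat (inj₁ i)))
             , All.tabulate λ v∈ → subst (λ v → sumOver (descLabels v) x ≤ ℕ→ℚ (length (descLabels v)))
                                         (sym (lookup-index v∈)) (sat (inj₂ (index v∈)))

  open Polyhedron (Sum.≡-dec Fin._≟_ Fin._≟_) constraints ∈-constraints f f-linear b (Q t) Q⇔constraints public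

  labelled : ∀ i → i ∈ descLabels t
  labelled i = ∈-resp-↭ (↭-sym (proj₂ arbor)) (∈-allFin i)

  labelled-once : Unique (descLabels t)
  labelled-once = Unique-resp-↭ (setoid (Fin n)) (↭⇒↭ₛ (↭-sym (proj₂ arbor))) (allFin⁺ n)

  labels-unique : Unique (concatMap label (subtrees t))
  labels-unique = subst Unique (descLabels≡concat t) labelled-once

  position : Fin n → Fin m
  position i = index (∈-descLabels⁻ t (labelled i))

  position-unique : ∀ {i p} → i ∈ label (vertex p) → position i ≡ p
  position-unique {i} i∈ = label-position-unique (subtrees t) labels-unique (lookup-index (∈-descLabels⁻ t (labelled i))) i∈

  position-of : ∀ {s} (s∈ : s ∈ subtrees t) {i} → i ∈ label s → position i ≡ index s∈
  position-of s∈ {i} i∈s = position-unique (subst (λ v → i ∈ label v) (lookup-index s∈) i∈s)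

  bounded : Bounded (Q t)
  bounded = M , λ x (0≤x , bounds) i → ≤-trans -M≤0 (0≤x i)
                                      , ≤-trans (x≤sumOver 0≤x (labelled i)) (All.lookup bounds (self∈subtrees t))
    where
    M = ℕ→ℚ (length (descLabels t))
    -M≤0 : 0ℚ - M ≤ 0ℚ
    -M≤0 = subst (_≤ 0ℚ) (sym (+-identityˡ (- M))) (neg-antimono-≤ (ℕ→ℚ-nonNeg (length (descLabels t))))

  simplex⊆Q : ∀ j → Q t (simplex j)
  simplex⊆Q Fin.zero = unit-cube⊆Q t (λ _ → ≤-refl) (λ _ → <⇒≤ 0<1)
  simplex⊆Q (Fin.suc i) = unit-cube⊆Q t (unit-nonNeg i) (unit-≤1 i)

  module AtVertex {x : Point n} (x-vertex : IsVertex (Q t) x) where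

    x∈Q : Q t x
    x∈Q = proj₁ x-vertex

    assigned : Fin n → Constraint
    assigned i with 0ℚ <? x i
    ... | yes _ = inj₂ (position i)
    ... | no _ = inj₁ i

    assigned-pos : ∀ {i} → 0ℚ < x i → assigned i ≡ inj₂ (position i)
    assigned-pos {i} 0<xi with 0ℚ <? x i
    ... | yes _ = refl
    ... | no 0≮xi = contradiction 0<xi 0≮xi

    assigned-zero : ∀ {i} → x i ≡ 0ℚ → assigned i ≡ inj₁ i
    assigned-zero {i} xi≡0 with 0ℚ <? x i
    ... | yes 0<xi = contradiction (sym xi≡0) (<⇒≢ 0<xi)
    ... | no _ = refl

    covers : Covers x assigned
    covers (inj₁ i) active = i , assigned-zero (neg-injective active)
    covers (inj₂ p) active =
      let i , i∈ , 0<xi = active⇒positive-label t x∈Q (∈-lookup p) (All.lookup (proj₁ arbor) (∈-lookup p)) active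
      in i , trans (assigned-pos 0<xi) (cong inj₂ (position-unique i∈))

    open Cover (vertex⇒basic x-vertex) covers

    vertex-active : ∀ {s} → s ∈ subtrees t → ∀ {i} → i ∈ label s → 0ℚ < x i
                  → sumOver (descLabels s) x ≡ ℕ→ℚ (length (descLabels s))
    vertex-active s∈ {i} i∈s 0<xi =
      subst (λ v → sumOver (descLabels v) x ≡ ℕ→ℚ (length (descLabels v))) (sym (lookup-index s∈))
            (subst (λ p → Active x (inj₂ p)) (position-of s∈ i∈s)
                   (subst (Active x) (assigned-pos 0<xi) (cover-active i)))

    label-mates : ∀ {s} → s ∈ subtrees t → ∀ {i j} → i ∈ label s → j ∈ label s
                → 0ℚ < x i → 0ℚ < x j → i ≡ j
    label-mates s∈ {i} {j} i∈s j∈s 0<xi 0<xj = cover-injective (begin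
      assigned i                ≡⟨ assigned-pos 0<xi ⟩
      inj₂ (position i)         ≡⟨ cong inj₂ (trans (position-of s∈ i∈s) (sym (position-of s∈ j∈s))) ⟩
      inj₂ (position j)         ≡⟨ assigned-pos 0<xj ⟨
      assigned j                ∎)
      where open ≡-Reasoning

    -- Top down: a positive coordinate is its vertex's size minus the (integral) sum over the children.
    integral : ∀ {s} → s ∈ subtrees t → Unique (descLabels s) → ∀ {i} → i ∈ descLabels s → Integral (x i)
    integralF : ∀ {cs} → (∀ {c} → c ∈ cs → c ∈ subtrees t) → Unique (descLabelsF cs)
              → ∀ {i} → i ∈ descLabelsF cs → Integral (x i)
    integral {node l cs} s∈ unique {i} i∈ with ∈-++⁻ l i∈
    ... | inj₂ i∈cs = integralF (child∈subtrees s∈) (Unique-++⁻ʳ l unique) i∈cs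
    ... | inj₁ i∈l with 0ℚ <? x i
    ...   | no 0≮xi = ℤ.+ 0 , ≤-antisym (≮⇒≥ 0≮xi) (proj₁ x∈Q i)
    ...   | yes 0<xi = subst Integral (sym xi≡)
                         (integral-+ (ℕ→ℚ-integral (length (l ++ descLabelsF cs)))
                                     (integral-‿- (sumOver-integral λ j →
                                       integralF (child∈subtrees s∈) (Unique-++⁻ʳ l unique))))
      where
      rest = sumOver (descLabelsF cs) x
      sum-label : sumOver l x ≡ x i
      sum-label = sumOver-single (Unique-++⁻ˡ l unique) i∈l λ j j∈l j≢i →
        ≤-antisym (≮⇒≥ λ 0<xj → j≢i (label-mates s∈ j∈l i∈l 0<xj 0<xi)) (proj₁ x∈Q j)
      xi≡ : x i ≡ ℕ→ℚ (length (l ++ descLabelsF cs)) + - rest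
      xi≡ = begin
        x i                                         ≡⟨ sum-label ⟨
        sumOver l x                                 ≡⟨ a≡a+c-c (sumOver l x) rest ⟩
        (sumOver l x + rest) + - rest               ≡⟨ cong (_+ - rest) (sumOver-++ l (descLabelsF cs) x) ⟨
        sumOver (l ++ descLabelsF cs) x + - rest    ≡⟨ cong (_+ - rest) (vertex-active s∈ i∈l 0<xi) ⟩
        ℕ→ℚ (length (l ++ descLabelsF cs)) + - rest ∎
        where
        open ≡-Reasoning
        a≡a+c-c : ∀ a c → a ≡ (a + c) + - c
        a≡a+c-c = solve-∀ ℚ-ring
    integralF {c ∷ cs} cs⊆ unique i∈ with ∈-++⁻ (descLabels c) i∈
    ... | inj₁ i∈c = integral (cs⊆ (here refl)) (Unique-++⁻ˡ (descLabels c) unique) i∈c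
    ... | inj₂ i∈cs = integralF (cs⊆ ∘ there) (Unique-++⁻ʳ (descLabels c) unique) i∈cs

lemma1p2 : ∀ (n : ℕ) (t : Tree n) → IsArbor t
         → Bounded (Q t) × IsLattice (Q t) × IsSimple (Q t)
lemma1p2 n t arbor = bounded , lattice , simple bounded (hasDim-of-simplex (Q t) simplex⊆Q) cover
  where
  open Arbor t arbor
  lattice : IsLattice (Q t)
  lattice x x-vertex i = AtVertex.integral x-vertex (self∈subtrees t) labelled-once (labelled i)
  cover : ∀ x → IsVertex (Q t) x → Σ (Fin n → Constraint) (Covers x)
  cover x x-vertex = AtVertex.assigned x-vertex , AtVertex.covers x-vertex
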